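{- Let $n\geq1$ and $d\geq1$. Then \[ \mathfrak{F}^{ITC}_{n,d}(q,t)=\sum_{k=1}^{n+1}\ \sum_{[(b_1,\ldots,b_k),(a_1,\ldots,a_k)]\in\mathsf{ITC}_{n,d,k}}\ \prod_{i=1}^k q^{\binom{a_i}{2}}\binom{a_i+b_i+a_{i-1}-1}{a_i,\,b_i,\,a_{i-1}-1}_q t^{(i-1)(a_i+b_i)}, \] where $a_0:=1$.
   Context: The complete split graph $S_{n,d}$ has vertices $s,v_1,\ldots,v_n$ and $w_1,\ldots,w_d$; any two distinct vertices among $s,v_1,\ldots,v_n$ are adjacent, each $w_j$ is adjacent to each of $s,v_1,\ldots,v_n$, no two $w_j$'s are adjacent; $s$ is the sink, $\deg(v_i)=n+d$, $\deg(w_j)=n+1$. A configuration assigns non-negative integers to non-sink vertices. A non-sink vertex $v$ is unstable if its number of grains is $\ge\deg(v)$; toppling $v$ removes $\deg(v)$ grains from $v$ (if $v\neq s$) and adds one grain to each non-sink neighbour. A stable configuration $c$ is recurrent iff there is an ordering $s=u_0,\ldots,u_{n+d}$ of all vertices such that from $c$, toppling $u_0,\ldots,u_{i-1}$ in turn makes $u_i$ unstable for each $i\ge1$. $\mathsf{SortedRec}(S_{n,d})$: recurrent configurations $(c(v_1),\ldots,c(v_n);c(w_1),\ldots,c(w_d))$ with both parts weakly decreasing. $\mathsf{level}(c)=\sum(\text{entries})-\left(\binom{n+d}2-\binom d2\right)$. ITC toppling of $c$: topple the sink; then for $i=1,2,\ldots$ topple simultaneously the set $Q'_i$ of currently unstable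 independent vertices, then the set $P'_i$ of currently unstable clique vertices; stop after the first $i=k$ at which the configuration is stable. $\mathsf{wtopple}_{ITC}(c)=\sum_{i=1}^k i(|Q'_i|+|P'_i|)$; the ITC-toppling sequence of $c$ is $[(|Q'_1|,\ldots,|Q'_k|),(|P'_1|,\ldots,|P'_k|)]$, of length $k$. $\mathsf{ITC}_{n,d,k}$ is the set of ITC-toppling sequences of length $k$ of elements of $\mathsf{SortedRec}(S_{n,d})$. $\mathfrak{F}^{ITC}_{n,d}(q,t)=\sum_{c\in\mathsf{SortedRec}(S_{n,d})}q^{\mathsf{level}(c)}t^{\mathsf{wtopple}_{ITC}(c)-(n+d)}$. The $q$-multinomial coefficient is $\binom{a+b+c}{a,b,c}_q=\frac{[a+b+c]_q!}{[a]_q![b]_q![c]_q!}$ with $[m]_q!=\prod_{j=1}^m(1+q+\cdots+q^{j-1})$. -}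

module Defs where

open import Data.Bool using (Bool; true; false; not; _∧_; if_then_else_)
open import Data.Nat as ℕ using (ℕ; zero; suc; _+_; _*_; _∸_; _^_; _/_)
open import Data.Nat.Combinatorics using (_C_)
open import Data.Fin using (Fin; _≟_)
import Data.Fin as Fin
open import Data.Integer as ℤ using (ℤ; +_)
open import Data.Vec as Vec using (Vec; lookup)
open import Data.List using (List; []; _∷_; _++_; map; allFin; upTo; length; filter; deduplicate)
open import Data.Nat.ListAction using (sum)
open import Data.List.Relation.Binary.Permutation.Propositional using (_↭_)
open import Data.Product using (Σ; _×_; _,_; proj₁; proj₂)
open import Data.Unit using (⊤)
open import Relation.Nullary using (does; ¬_)
open import Relation.Binary.PropositionalEquality using (_≡_)
import Data.List.Properties as LP
import Data.Product.Properties as PP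
import Data.Nat.Properties as NP

data Vtx (n d : ℕ) : Set where
  sink : Vtx n d
  v    : Fin n → Vtx n d
  w    : Fin d → Vtx n d

allV : (n d : ℕ) → List (Vtx n d)
allV n d = sink ∷ (map v (allFin n) ++ map w (allFin d))

adj : ∀ {n d} → Vtx n d → Vtx n d → Bool
adj sink  sink  = false
adj sink  (v _) = true
adj sink  (w _) = true
adj (v _) sink  = true
adj (v i) (v j) = not (does (i ≟ j))
adj (v _) (w _) = true
adj (w _) sink  = true
adj (w _) (v _) = true
adj (w _) (w _) = false

deg : ∀ {n d} → Vtx n d → ℕ
deg {n} {d} sink  = n + d
deg {n} {d} (v _) = n + d
deg {n} {d} (w _) = n + 1

isSink : ∀ {n d} → Vtx n d → Bool
isSink sink = true
isSink _    = false

NonSink : ∀ {n d} → Vtx n d → Set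
NonSink x = isSink x ≡ false

-- Configurations (values on the sink are irrelevant; kept unchanged)

Config : ℕ → ℕ → Set
Config n d = Vtx n d → ℤ

countB : ∀ {A : Set} → (A → Bool) → List A → ℕ
countB p []       = 0
countB p (x ∷ xs) = if p x then suc (countB p xs) else countB p xs

toppleSet : ∀ {n d} → (Vtx n d → Bool) → Config n d → Config n d
toppleSet S c sink = c sink
toppleSet {n} {d} S c x =
  (c x ℤ.- (if S x then + deg x else + 0)) ℤ.+ + countB (λ u → S u ∧ adj u x) (allV n d)

topple : ∀ {n d} → Vtx n d → Config n d → Config n d
topple u = toppleSet (λ x → eqV u x)
  where
  eqV : ∀ {n d} → Vtx n d → Vtx n d → Bool
  eqV sink  sink  = true
  eqV (v i) (v j) = does (i ≟ j)
  eqV (w i) (w j) = does (i ≟ j)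
  eqV _     _     = false

Unstable : ∀ {n d} → Config n d → Vtx n d → Set
Unstable c x = NonSink x × (+ deg x ℤ.≤ c x)

Stable : ∀ {n d} → Config n d → Set
Stable c = ∀ x → NonSink x → c x ℤ.< + deg x

unstableB : ∀ {n d} → Config n d → Vtx n d → Bool
unstableB c sink = false
unstableB c x    = + deg x ℤ.≤ᵇ c x

ValidSeq : ∀ {n d} → Config n d → List (Vtx n d) → Set
ValidSeq c []       = ⊤
ValidSeq c (u ∷ us) = Unstable c u × ValidSeq (topple u c) us

-- recurrence, via the ordering characterisation of the paper
Recurrent : ∀ {n d} → Config n d → Set
Recurrent {n} {d} c =
  Stable c × Σ (List (Vtx n d)) λ rest →
    ((sink ∷ rest) ↭ allV n d) × ValidSeq (topple sink c) rest

SConf : ℕ → ℕ → Set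
SConf n d = Vec ℕ n × Vec ℕ d

toConfig : ∀ {n d} → SConf n d → Config n d
toConfig c sink  = + 0
toConfig c (v i) = + lookup (proj₁ c) i
toConfig c (w j) = + lookup (proj₂ c) j

WeaklyDecreasing : ∀ {m} → Vec ℕ m → Set
WeaklyDecreasing {m} xs = ∀ (i j : Fin m) → i Fin.≤ j → lookup xs j ℕ.≤ lookup xs i

SortedRec : ∀ {n d} → SConf n d → Set
SortedRec c = WeaklyDecreasing (proj₁ c) × WeaklyDecreasing (proj₂ c) × Recurrent (toConfig c)

level : ∀ {n d} → SConf n d → ℕ
level {n} {d} c = (Vec.sum (proj₁ c) + Vec.sum (proj₂ c)) ∸ (((n + d) C 2) ∸ (d C 2))

isW isV : ∀ {n d} → Vtx n d → Bool
isW (w _) = true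
isW _     = false
isV (v _) = true
isV _     = false

stableB : ∀ {n d} → Config n d → Bool
stableB {n} {d} c = countB (unstableB c) (allV n d) ℕ.≡ᵇ 0

itcRound : ∀ {n d} → Config n d → (ℕ × ℕ) × Config n d
itcRound {n} {d} c =
  let Q  = λ x → isW x ∧ unstableB c x
      c₁ = toppleSet Q c
      P  = λ x → isV x ∧ unstableB c₁ x
      c₂ = toppleSet P c₁
  in (countB Q (allV n d) , countB P (allV n d)) , c₂

itcRun : ∀ {n d} → ℕ → Config n d → List (ℕ × ℕ)
itcRun zero    c = []
itcRun (suc f) c with itcRound c
... | r , c₂ = r ∷ (if stableB c₂ then [] else itcRun f c₂)

-- ITC-toppling sequence [(|Q'_i|), (|P'_i|)] as the list of pairs (|Q'_i|,|P'_i|)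
itcSeq : ∀ {n d} → SConf n d → List (ℕ × ℕ)
itcSeq {n} {d} c = itcRun (suc (n + d)) (topple sink (toConfig c))

wsum : ℕ → List (ℕ × ℕ) → ℕ
wsum i []             = 0
wsum i ((b , a) ∷ rs) = i * (b + a) + wsum (suc i) rs

wtopple : ∀ {n d} → SConf n d → ℕ
wtopple c = wsum 1 (itcSeq c)

-- q-analogues, evaluated at a natural number q

qint : ℕ → ℕ → ℕ
qint q zero    = 0
qint q (suc m) = q ^ m + qint q m

qfact : ℕ → ℕ → ℕ
qfact q zero    = 1
qfact q (suc m) = qint q (suc m) * qfact q m

-- division (the divisor below is never 0)
_div_ : ℕ → ℕ → ℕ
m div zero  = 0
m div suc k = m / suc k

qmultinom : ℕ → ℕ → ℕ → ℕ → ℕ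
qmultinom q a b c = qfact q (a + b + c) div (qfact q a * qfact q b * qfact q c)

-- The two sides, evaluated at (q,t), given a duplicate-free list L
-- enumerating SortedRec(S_{n,d})

FITC : ∀ {n d} → List (SConf n d) → ℕ → ℕ → ℕ
FITC {n} {d} L q t = sum (map (λ c → q ^ level c * t ^ (wtopple c ∸ (n + d))) L)

ITCset : ∀ {n d} → List (SConf n d) → ℕ → List (List (ℕ × ℕ))
ITCset L k =
  deduplicate (LP.≡-dec (PP.≡-dec NP._≟_ NP._≟_))
    (filter (λ s → length s NP.≟ k) (map itcSeq L))

-- prod_{i} q^{C(a_i,2)} binom(a_i+b_i+a_{i-1}-1; a_i,b_i,a_{i-1}-1)_q t^{(i-1)(a_i+b_i)}
-- arguments: index i, a_{i-1}, remaining pairs (b_i , a_i)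
itcTerm : ℕ → ℕ → ℕ → ℕ → List (ℕ × ℕ) → ℕ
itcTerm q t i aprev []             = 1
itcTerm q t i aprev ((b , a) ∷ rs) =
  q ^ (a C 2) * qmultinom q a b (aprev ∸ 1) * t ^ ((i ∸ 1) * (a + b))
    * itcTerm q t (suc i) a rs

RHS : ∀ {n d} → List (SConf n d) → ℕ → ℕ → ℕ
RHS {n} {d} L q t =
  sum (map (λ k → sum (map (itcTerm q t 1 1) (ITCset L k))) (map suc (upTo (n + 1))))

module Submission where

-- Both parts of a sorted configuration are weakly decreasing, so every round of ITC toppling topples
-- a prefix of the clique vertices and a prefix of the independent ones, and how long these prefixes
-- become is read off from how many entries of x and y lie above thresholds that depend only on how
-- many vertices have toppled before. Hence the ITC sequence s of (x, y) is a function of these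
-- counts, recurrence means that the process ends with every vertex toppled, and the sorted recurrent
-- configurations with sequence s are exactly the decreasing vectors with prescribed numbers of
-- entries above each threshold of s. Such vectors split into independent blocks of entries, each an
-- arbitrary decreasing vector in an interval, whose generating function is a q-binomial coefficient.
-- In round i the clique block has aᵢ entries in an interval of width bᵢ + aᵢ₋₁ and the independent
-- block bᵢ entries in one of width aᵢ₋₁, which gives the q-multinomial coefficient; the least entry
-- sums account for the level offset and for the factors q^C(aᵢ,2). Grouping the configurations by
-- their sequence, and the sequences by their length, yields the right-hand side.

module Sums where

  open import Data.Nat using (ℕ; _+_; _*_)
  open import Data.Nat.Properties
  open import Algebra.Properties.CommutativeSemigroup +-commutativeSemigroup using (interchange)
  open import Data.Nat.ListAction using (sum)
  open import Data.Nat.ListAction.Properties using (sum-++; sum-↭)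
  open import Data.Bool using (true; false; if_then_else_)
  open import Data.List using (List; []; _∷_; _++_; map; concatMap; filter; cartesianProduct)
  open import Data.List.Properties using (map-++; map-∘)
  open import Data.List.Membership.Propositional using (_∈_; find)
  open import Data.List.Membership.Propositional.Properties using (∈-filter⁺; ∈-filter⁻; ∈-concatMap⁻)
  open import Data.List.Membership.Propositional.Properties.WithK using (unique∧set⇒bag)
  open import Data.List.Relation.Binary.BagAndSetEquality using (∼bag⇒↭)
  open import Data.List.Relation.Binary.Permutation.Propositional using (_↭_)
  open import Data.List.Relation.Binary.Permutation.Propositional.Properties using (map⁺)
  open import Data.List.Relation.Unary.Any using (here; there)
  open import Data.List.Relation.Unary.AllPairs using ([]; _∷_)
  import Data.List.Relation.Unary.All as All
  open import Data.List.Relation.Unary.Unique.Propositional using (Unique)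
  import Data.List.Relation.Unary.Unique.Propositional.Properties as Unique
  open import Data.Product using (_×_; _,_)
  open import Data.Empty using (⊥; ⊥-elim)
  open import Function.Bundles using (mk⇔)
  open import Relation.Binary.Definitions using (DecidableEquality)
  open import Relation.Binary.PropositionalEquality
  open import Relation.Nullary using (Dec; does; yes; no)
  open ≡-Reasoning

  private
    variable
      A B : Set

  ∑ : List A → (A → ℕ) → ℕ
  ∑ xs f = sum (map f xs)

  ∑-++ : ∀ (xs ys : List A) f → ∑ (xs ++ ys) f ≡ ∑ xs f + ∑ ys f
  ∑-++ xs ys f = trans (cong sum (map-++ f xs ys)) (sum-++ (map f xs) (map f ys))

  ∑-map : ∀ (xs : List A) (g : A → B) f → ∑ (map g xs) f ≡ ∑ xs (λ x → f (g x))
  ∑-map xs g f = cong sum (sym (map-∘ xs))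

  ∑-concatMap : ∀ (xs : List A) (g : A → List B) f → ∑ (concatMap g xs) f ≡ ∑ xs (λ x → ∑ (g x) f)
  ∑-concatMap []       g f = refl
  ∑-concatMap (x ∷ xs) g f = trans (∑-++ (g x) (concatMap g xs) f) (cong (∑ (g x) f +_) (∑-concatMap xs g f))

  ∑-cong : ∀ (xs : List A) {f g} → (∀ x → x ∈ xs → f x ≡ g x) → ∑ xs f ≡ ∑ xs g
  ∑-cong []       f≡g = refl
  ∑-cong (x ∷ xs) f≡g = cong₂ _+_ (f≡g x (here refl)) (∑-cong xs (λ y y∈xs → f≡g y (there y∈xs)))

  ∑-zero : ∀ (xs : List A) {f} → (∀ x → x ∈ xs → f x ≡ 0) → ∑ xs f ≡ 0
  ∑-zero []       f≡0 = refl
  ∑-zero (x ∷ xs) f≡0 = cong₂ _+_ (f≡0 x (here refl)) (∑-zero xs (λ y y∈xs → f≡0 y (there y∈xs)))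

  ∑-*ˡ : ∀ (xs : List A) k f → ∑ xs (λ x → k * f x) ≡ k * ∑ xs f
  ∑-*ˡ []       k f = sym (*-zeroʳ k)
  ∑-*ˡ (x ∷ xs) k f = trans (cong (k * f x +_) (∑-*ˡ xs k f)) (sym (*-distribˡ-+ k (f x) _))

  ∑-*ʳ : ∀ (xs : List A) k f → ∑ xs (λ x → f x * k) ≡ ∑ xs f * k
  ∑-*ʳ []       k f = refl
  ∑-*ʳ (x ∷ xs) k f = trans (cong (f x * k +_) (∑-*ʳ xs k f)) (sym (*-distribʳ-+ k (f x) _))

  ∑-+ : ∀ (xs : List A) f g → ∑ xs (λ x → f x + g x) ≡ ∑ xs f + ∑ xs g
  ∑-+ []       f g = refl
  ∑-+ (x ∷ xs) f g = trans (cong (f x + g x +_) (∑-+ xs f g)) (interchange (f x) (g x) (∑ xs f) (∑ xs g))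

  ∑-comm : ∀ (xs : List A) (ys : List B) (f : A → B → ℕ) → ∑ xs (λ x → ∑ ys (f x)) ≡ ∑ ys (λ y → ∑ xs (λ x → f x y))
  ∑-comm []       ys f = sym (∑-zero ys (λ _ _ → refl))
  ∑-comm (x ∷ xs) ys f = trans (cong (∑ ys (f x) +_) (∑-comm xs ys f)) (sym (∑-+ ys (f x) (λ y → ∑ xs (λ x → f x y))))

  ∑-filter : ∀ {P : A → Set} (P? : ∀ x → Dec (P x)) (xs : List A) f →
    ∑ (filter P? xs) f ≡ ∑ xs (λ x → if does (P? x) then f x else 0)
  ∑-filter P? []       f = refl
  ∑-filter P? (x ∷ xs) f with does (P? x)
  ... | true  = cong (f x +_) (∑-filter P? xs f)
  ... | false = ∑-filter P? xs f

  unique-↭ : ∀ {xs ys : List A} → Unique xs → Unique ys → (∀ {z} → z ∈ xs → z ∈ ys) → (∀ {z} → z ∈ ys → z ∈ xs) → xs ↭ ys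
  unique-↭ !xs !ys xs⊆ys ys⊆xs = ∼bag⇒↭ (unique∧set⇒bag !xs !ys (mk⇔ xs⊆ys ys⊆xs))

  ∑-unique : ∀ (xs ys : List A) → Unique xs → Unique ys → (∀ {z} → z ∈ xs → z ∈ ys) → (∀ {z} → z ∈ ys → z ∈ xs) →
    ∀ f → ∑ xs f ≡ ∑ ys f
  ∑-unique xs ys !xs !ys xs⊆ys ys⊆xs f = sum-↭ (map⁺ f (unique-↭ !xs !ys xs⊆ys ys⊆xs))

  ∑-filter-unique : ∀ {P Q : A → Set} (P? : ∀ x → Dec (P x)) (Q? : ∀ x → Dec (Q x)) (xs ys : List A) →
    Unique xs → Unique ys → (∀ {z} → z ∈ xs → P z → z ∈ ys × Q z) → (∀ {z} → z ∈ ys → Q z → z ∈ xs × P z) →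
    ∀ f → ∑ xs (λ x → if does (P? x) then f x else 0) ≡ ∑ ys (λ y → if does (Q? y) then f y else 0)
  ∑-filter-unique P? Q? xs ys !xs !ys xs⇒ys ys⇒xs f = begin
    ∑ xs (λ x → if does (P? x) then f x else 0) ≡⟨ ∑-filter P? xs f ⟨
    ∑ (filter P? xs) f                          ≡⟨ ∑-unique _ _ (Unique.filter⁺ P? !xs) (Unique.filter⁺ Q? !ys) to from f ⟩
    ∑ (filter Q? ys) f                          ≡⟨ ∑-filter Q? ys f ⟩
    ∑ ys (λ y → if does (Q? y) then f y else 0) ∎
    where
    to : ∀ {z} → z ∈ filter P? xs → z ∈ filter Q? ys
    to z∈ with ∈-filter⁻ P? z∈
    ... | z∈xs , Pz with xs⇒ys z∈xs Pz
    ... | z∈ys , Qz = ∈-filter⁺ Q? z∈ys Qz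
    from : ∀ {z} → z ∈ filter Q? ys → z ∈ filter P? xs
    from z∈ with ∈-filter⁻ Q? z∈
    ... | z∈ys , Qz with ys⇒xs z∈ys Qz
    ... | z∈xs , Pz = ∈-filter⁺ P? z∈xs Pz

  ∑-indicator : ∀ (_≟_ : DecidableEquality B) (ys : List B) {x} k → Unique ys → x ∈ ys →
    ∑ ys (λ y → if does (x ≟ y) then k else 0) ≡ k
  ∑-indicator _≟_ (y ∷ ys) {x} k (y∉ys ∷ !ys) x∈ with x ≟ y
  ∑-indicator _≟_ (y ∷ ys) {x} k (y∉ys ∷ !ys) x∈ | yes refl = trans (cong (k +_) (∑-zero ys others)) (+-identityʳ k)
    where
    others : ∀ z → z ∈ ys → (if does (x ≟ z) then k else 0) ≡ 0
    others z z∈ys with x ≟ z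
    ... | yes refl = ⊥-elim (All.lookup y∉ys z∈ys refl)
    ... | no _     = refl
  ∑-indicator _≟_ (y ∷ ys) k (_ ∷ _)      (here refl)  | no x≢y = ⊥-elim (x≢y refl)
  ∑-indicator _≟_ (y ∷ ys) k (_ ∷ !ys)    (there x∈ys) | no _   = ∑-indicator _≟_ ys k !ys x∈ys

  ∑-fibres : ∀ (_≟_ : DecidableEquality B) (xs : List A) (ys : List B) (g : A → B) f → Unique ys → (∀ x → x ∈ xs → g x ∈ ys) →
    ∑ xs f ≡ ∑ ys (λ y → ∑ xs (λ x → if does (g x ≟ y) then f x else 0))
  ∑-fibres _≟_ xs ys g f !ys g∈ys =
    trans (∑-cong xs (λ x x∈xs → sym (∑-indicator _≟_ ys (f x) !ys (g∈ys x x∈xs))))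
          (∑-comm xs ys (λ x y → if does (g x ≟ y) then f x else 0))

  Unique-concatMap : ∀ (xs : List A) {g : A → List B} → Unique xs → (∀ x → Unique (g x)) →
    (∀ {x x′ z} → z ∈ g x → z ∈ g x′ → x ≡ x′) → Unique (concatMap g xs)
  Unique-concatMap []       _             _   _        = []
  Unique-concatMap (x ∷ xs) {g} (x∉xs ∷ !xs) !g disjoint =
    Unique.++⁺ (!g x) (Unique-concatMap xs !xs !g disjoint) (λ (z∈gx , z∈rest) → not-later z∈gx z∈rest)
    where
    not-later : ∀ {z} → z ∈ g x → z ∈ concatMap g xs → ⊥
    not-later z∈gx z∈rest with find (∈-concatMap⁻ g {xs = xs} z∈rest)
    ... | x′ , x′∈xs , z∈gx′ = All.lookup x∉xs x′∈xs (disjoint z∈gx z∈gx′)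

  ∑-cartesianProduct : ∀ (xs : List A) (ys : List B) f → ∑ (cartesianProduct xs ys) f ≡ ∑ xs (λ x → ∑ ys (λ y → f (x , y)))
  ∑-cartesianProduct []       ys f = refl
  ∑-cartesianProduct (x ∷ xs) ys f =
    trans (∑-++ (map (x ,_) ys) (cartesianProduct xs ys) f) (cong₂ _+_ (∑-map ys (x ,_) f) (∑-cartesianProduct xs ys f))

module QBinomial where

  open import Defs using (qint; qfact; qmultinom; _div_)
  open import Data.Nat
  open import Data.Nat.Properties
  open import Data.Nat.DivMod using (m*n/n≡m)
  open import Data.Nat.Solver using (module +-*-Solver)
  open import Relation.Binary.PropositionalEquality
  open +-*-Solver
  open ≡-Reasoning

  qbinom : ℕ → ℕ → ℕ → ℕ
  qbinom q N       zero    = 1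
  qbinom q zero    (suc K) = 0
  qbinom q (suc N) (suc K) = qbinom q N K + q ^ suc K * qbinom q N (suc K)

  qint-+ : ∀ q a b → qint q (a + b) ≡ qint q a + q ^ a * qint q b
  qint-+ q a zero = begin
    qint q (a + 0)         ≡⟨ cong (qint q) (+-identityʳ a) ⟩
    qint q a               ≡⟨ solve 2 (λ x p → x := x :+ p :* con 0) refl (qint q a) (q ^ a) ⟩
    qint q a + q ^ a * 0   ∎
  qint-+ q a (suc b) = begin
    qint q (a + suc b)                            ≡⟨ cong (qint q) (+-suc a b) ⟩
    q ^ (a + b) + qint q (a + b)                  ≡⟨ cong₂ _+_ (^-distribˡ-+-* q a b) (qint-+ q a b) ⟩
    q ^ a * q ^ b + (qint q a + q ^ a * qint q b) ≡⟨ solve 4 (λ x y z w → x :* y :+ (z :+ x :* w) := z :+ x :* (y :+ w))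
                                                        refl (q ^ a) (q ^ b) (qint q a) (qint q b) ⟩
    qint q a + q ^ a * (q ^ b + qint q b)         ∎

  qbinom-beyond : ∀ q N K → qbinom q N (suc N + K) ≡ 0
  qbinom-beyond q zero    K = refl
  qbinom-beyond q (suc N) K = begin
    qbinom q N (suc N + K) + q ^ suc (suc N + K) * qbinom q N (suc (suc N + K))
      ≡⟨ cong₂ (λ u v → u + q ^ suc (suc N + K) * v) (qbinom-beyond q N K)
               (trans (cong (qbinom q N) (sym (+-suc (suc N) K))) (qbinom-beyond q N (suc K))) ⟩
    0 + q ^ suc (suc N + K) * 0 ≡⟨ *-zeroʳ (q ^ suc (suc N + K)) ⟩
    0 ∎

  qbinom-diag : ∀ q N → qbinom q N N ≡ 1
  qbinom-diag q zero    = refl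
  qbinom-diag q (suc N) = begin
    qbinom q N N + q ^ suc N * qbinom q N (suc N)
      ≡⟨ cong₂ (λ u v → u + q ^ suc N * v) (qbinom-diag q N) (trans (cong (qbinom q N) (sym (+-identityʳ (suc N)))) (qbinom-beyond q N 0)) ⟩
    1 + q ^ suc N * 0 ≡⟨ cong suc (*-zeroʳ (q ^ suc N)) ⟩
    1 ∎

  qbinom-qfact : ∀ q K M → qbinom q (K + M) K * qfact q K * qfact q M ≡ qfact q (K + M)
  qbinom-qfact q zero    M       = +-identityʳ _
  qbinom-qfact q (suc K) zero    = begin
    qbinom q (suc K + 0) (suc K) * qfact q (suc K) * 1
      ≡⟨ cong (λ z → qbinom q z (suc K) * qfact q (suc K) * 1) (+-identityʳ (suc K)) ⟩
    qbinom q (suc K) (suc K) * qfact q (suc K) * 1 ≡⟨ cong (λ z → z * qfact q (suc K) * 1) (qbinom-diag q (suc K)) ⟩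
    1 * qfact q (suc K) * 1                        ≡⟨ solve 1 (λ x → con 1 :* x :* con 1 := x) refl (qfact q (suc K)) ⟩
    qfact q (suc K)                                ≡⟨ cong (qfact q) (+-identityʳ (suc K)) ⟨
    qfact q (suc K + 0)                            ∎
  qbinom-qfact q (suc K) (suc M) = begin
    (X + q ^ suc K * qbinom q (K + suc M) (suc K)) * (qint q (suc K) * qfact q K) * (qint q (suc M) * qfact q M)
      ≡⟨ cong (λ z → (X + q ^ suc K * qbinom q z (suc K)) * (qint q (suc K) * qfact q K) * (qint q (suc M) * qfact q M)) (+-suc K M) ⟩
    (X + q ^ suc K * Y) * (qint q (suc K) * qfact q K) * (qint q (suc M) * qfact q M)
      ≡⟨ solve 7 (λ x p y a fk b fm → (x :+ p :* y) :* (a :* fk) :* (b :* fm) := (x :* fk :* (b :* fm)) :* a :+ p :* ((y :* (a :* fk) :* fm) :* b))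
           refl X (q ^ suc K) Y (qint q (suc K)) (qfact q K) (qint q (suc M)) (qfact q M) ⟩
    (X * qfact q K * qfact q (suc M)) * qint q (suc K) + q ^ suc K * ((Y * qfact q (suc K) * qfact q M) * qint q (suc M))
      ≡⟨ cong₂ (λ u w → u * qint q (suc K) + q ^ suc K * (w * qint q (suc M))) (qbinom-qfact q K (suc M)) (qbinom-qfact q (suc K) M) ⟩
    qfact q (K + suc M) * qint q (suc K) + q ^ suc K * (F * qint q (suc M))
      ≡⟨ cong (λ z → qfact q z * qint q (suc K) + q ^ suc K * (F * qint q (suc M))) (+-suc K M) ⟩
    F * qint q (suc K) + q ^ suc K * (F * qint q (suc M))
      ≡⟨ solve 4 (λ f a p b → f :* a :+ p :* (f :* b) := (a :+ p :* b) :* f) refl F (qint q (suc K)) (q ^ suc K) (qint q (suc M)) ⟩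
    (qint q (suc K) + q ^ suc K * qint q (suc M)) * F ≡⟨ cong (_* F) (qint-+ q (suc K) (suc M)) ⟨
    qint q (suc K + suc M) * F                       ≡⟨ cong (λ z → qint q (suc K + suc M) * qfact q z) (+-suc K M) ⟨
    qfact q (suc K + suc M)                          ∎
    where
    X = qbinom q (K + suc M) K
    Y = qbinom q (suc K + M) (suc K)
    F = qfact q (suc K + M)

  qint-suc-pos : ∀ q m → 1 ≤ qint q (suc m)
  qint-suc-pos q zero    = s≤s z≤n
  qint-suc-pos q (suc m) = ≤-trans (qint-suc-pos q m) (m≤n+m (qint q (suc m)) (q ^ suc m))

  qfact-pos : ∀ q m → 1 ≤ qfact q m
  qfact-pos q zero    = s≤s z≤n
  qfact-pos q (suc m) = *-mono-≤ (qint-suc-pos q m) (qfact-pos q m)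

  qmultinom-qbinom : ∀ q a b c → qmultinom q a b c ≡ qbinom q (a + (b + c)) a * qbinom q (b + c) b
  qmultinom-qbinom q a b c = begin
    qfact q (a + b + c) div D                                           ≡⟨ cong (_div D) factorisation ⟩
    (qbinom q (a + (b + c)) a * qbinom q (b + c) b * D) div D
      ≡⟨ exact-div (*-mono-≤ (*-mono-≤ (qfact-pos q a) (qfact-pos q b)) (qfact-pos q c)) ⟩
    qbinom q (a + (b + c)) a * qbinom q (b + c) b                       ∎
    where
    D = qfact q a * qfact q b * qfact q c
    exact-div : ∀ {x k} → 1 ≤ k → (x * k) div k ≡ x
    exact-div {x} {suc k} _ = m*n/n≡m x (suc k)
    factorisation : qfact q (a + b + c) ≡ qbinom q (a + (b + c)) a * qbinom q (b + c) b * D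
    factorisation = begin
      qfact q (a + b + c)                                                        ≡⟨ cong (qfact q) (+-assoc a b c) ⟩
      qfact q (a + (b + c))                                                      ≡⟨ qbinom-qfact q a (b + c) ⟨
      qbinom q (a + (b + c)) a * qfact q a * qfact q (b + c)                     ≡⟨ cong (qbinom q (a + (b + c)) a * qfact q a *_) (qbinom-qfact q b c) ⟨
      qbinom q (a + (b + c)) a * qfact q a * (qbinom q (b + c) b * qfact q b * qfact q c)
        ≡⟨ solve 5 (λ x fa y fb fc → x :* fa :* (y :* fb :* fc) := x :* y :* (fa :* fb :* fc)) refl
             (qbinom q (a + (b + c)) a) (qfact q a) (qbinom q (b + c) b) (qfact q b) (qfact q c) ⟩
      qbinom q (a + (b + c)) a * qbinom q (b + c) b * D ∎

  qbinom-sym : ∀ q K M → qbinom q (K + M) K ≡ qbinom q (K + M) M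
  qbinom-sym q K M = *-cancelʳ-≡ _ _ (qfact q K * qfact q M) {{>-nonZero (*-mono-≤ (qfact-pos q K) (qfact-pos q M))}} (begin
    qbinom q (K + M) K * (qfact q K * qfact q M) ≡⟨ *-assoc (qbinom q (K + M) K) _ _ ⟨
    qbinom q (K + M) K * qfact q K * qfact q M   ≡⟨ qbinom-qfact q K M ⟩
    qfact q (K + M)                              ≡⟨ cong (qfact q) (+-comm K M) ⟩
    qfact q (M + K)                              ≡⟨ qbinom-qfact q M K ⟨
    qbinom q (M + K) M * qfact q M * qfact q K   ≡⟨ cong (λ z → qbinom q z M * qfact q M * qfact q K) (+-comm M K) ⟩
    qbinom q (K + M) M * qfact q M * qfact q K   ≡⟨ solve 3 (λ x y z → x :* y :* z := x :* (z :* y)) refl (qbinom q (K + M) M) (qfact q M) (qfact q K) ⟩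
    qbinom q (K + M) M * (qfact q K * qfact q M) ∎)

module DecreasingVectors where

  open Sums
  open QBinomial using (qbinom; qbinom-diag)
  open import Data.Nat
  open import Data.Nat.Properties
  open import Data.List using (List; []; _∷_; map; concatMap; applyDownFrom)
  import Data.List as List
  open import Defs using (WeaklyDecreasing)
  open import Data.Fin using (Fin; zero; suc)
  open import Data.Vec using (Vec; []; _∷_; sum; lookup)
  open import Data.Vec.Properties using (∷-injectiveˡ; ∷-injectiveʳ)
  open import Data.Vec.Relation.Unary.All using (All; []; _∷_)
  import Data.Vec.Relation.Unary.All as All
  open import Data.List.Membership.Propositional using (_∈_; find; lose)
  open import Data.List.Membership.Propositional.Properties
    using (∈-map⁺; ∈-map⁻; ∈-applyDownFrom⁺; ∈-applyDownFrom⁻; ∈-concatMap⁺; ∈-concatMap⁻)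
  open import Data.List.Relation.Unary.Any using (here)
  open import Data.List.Relation.Unary.AllPairs using ([]; _∷_)
  import Data.List.Relation.Unary.All as ListAll
  open import Data.List.Relation.Unary.Unique.Propositional using (Unique)
  import Data.List.Relation.Unary.Unique.Propositional.Properties as Unique
  open import Data.Product using (_×_; _,_)
  open import Data.Unit using (⊤; tt)
  open import Relation.Binary.PropositionalEquality
  open ≡-Reasoning

  private
    variable
      a m : ℕ

  interval : ℕ → ℕ → List ℕ
  interval lo hi = applyDownFrom (lo +_) (hi ∸ lo)

  ∈-interval⁻ : ∀ {lo hi u} → u ∈ interval lo hi → lo ≤ u × u < hi
  ∈-interval⁻ {lo} {hi} u∈ with ∈-applyDownFrom⁻ (lo +_) u∈
  ... | i , i<hi∸lo , refl = m≤m+n lo i , subst (lo + i <_) (m+[n∸m]≡n lo≤hi) (+-monoʳ-< lo i<hi∸lo)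
    where
    lo≤hi : lo ≤ hi
    lo≤hi = <⇒≤ (m∸n≢0⇒n<m (λ hi∸lo≡0 → n≮0 (subst (i <_) hi∸lo≡0 i<hi∸lo)))

  ∈-interval⁺ : ∀ {lo hi u} → lo ≤ u → u < hi → u ∈ interval lo hi
  ∈-interval⁺ {lo} {hi} {u} lo≤u u<hi =
    subst (_∈ interval lo hi) (m+[n∸m]≡n lo≤u) (∈-applyDownFrom⁺ (lo +_) (∸-monoˡ-< u<hi lo≤u))

  interval-unique : ∀ lo hi → Unique (interval lo hi)
  interval-unique lo hi = Unique.applyDownFrom⁺₁ (lo +_) (hi ∸ lo) (λ j<i _ eq → <⇒≢ j<i (sym (+-cancelˡ-≡ lo _ _ eq)))

  interval-split : ∀ {θ hi} → θ ≤ hi → interval 0 hi ≡ interval θ hi List.++ interval 0 θ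
  interval-split {θ} {hi} θ≤hi = trans (cong (applyDownFrom (0 +_)) (sym (m∸n+n≡m θ≤hi))) (split (hi ∸ θ))
    where
    split : ∀ j → applyDownFrom (0 +_) (j + θ) ≡ applyDownFrom (θ +_) j List.++ applyDownFrom (0 +_) θ
    split zero    = refl
    split (suc j) = cong₂ _∷_ (+-comm j θ) (split j)

  DecreasingIn : Vec ℕ a → ℕ → ℕ → Set
  DecreasingIn []      lo hi = ⊤
  DecreasingIn (u ∷ x) lo hi = lo ≤ u × u < hi × DecreasingIn x lo (suc u)

  decreasingVecs : (a : ℕ) → ℕ → ℕ → List (Vec ℕ a)
  decreasingVecs zero    lo hi = [] ∷ []
  decreasingVecs (suc a) lo hi = concatMap (λ u → map (u ∷_) (decreasingVecs a lo (suc u))) (interval lo hi)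

  ∈-decreasingVecs⁻ : ∀ a lo hi {x} → x ∈ decreasingVecs a lo hi → DecreasingIn x lo hi
  ∈-decreasingVecs⁻ zero    lo hi {[]} _  = tt
  ∈-decreasingVecs⁻ (suc a) lo hi x∈ with find (∈-concatMap⁻ _ {xs = interval lo hi} x∈)
  ... | u , u∈ , x∈u∷ with ∈-map⁻ (u ∷_) x∈u∷
  ... | x′ , x′∈ , refl with ∈-interval⁻ u∈
  ... | lo≤u , u<hi = lo≤u , u<hi , ∈-decreasingVecs⁻ a lo (suc u) x′∈

  ∈-decreasingVecs⁺ : ∀ a lo hi (x : Vec ℕ a) → DecreasingIn x lo hi → x ∈ decreasingVecs a lo hi
  ∈-decreasingVecs⁺ zero    lo hi []      _                 = here refl
  ∈-decreasingVecs⁺ (suc a) lo hi (u ∷ x) (lo≤u , u<hi , x↓) =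
    ∈-concatMap⁺ _ (lose (∈-interval⁺ lo≤u u<hi) (∈-map⁺ (u ∷_) (∈-decreasingVecs⁺ a lo (suc u) x x↓)))

  decreasingVecs-unique : ∀ a lo hi → Unique (decreasingVecs a lo hi)
  decreasingVecs-unique zero    lo hi = ListAll.[] ∷ []
  decreasingVecs-unique (suc a) lo hi =
    Unique-concatMap (interval lo hi) (interval-unique lo hi) (λ u → Unique.map⁺ ∷-injectiveʳ (decreasingVecs-unique a lo (suc u))) same-head
    where
    same-head : ∀ {u u′} {x : Vec ℕ (suc a)} →
      x ∈ map (u ∷_) (decreasingVecs a lo (suc u)) → x ∈ map (u′ ∷_) (decreasingVecs a lo (suc u′)) → u ≡ u′
    same-head x∈ x∈′ with ∈-map⁻ _ x∈ | ∈-map⁻ _ x∈′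
    ... | _ , _ , refl | _ , _ , eq = ∷-injectiveˡ eq

  ∑-decreasingVecs-suc : ∀ lo hi (f : Vec ℕ (suc m) → ℕ) →
    ∑ (decreasingVecs (suc m) lo hi) f ≡ ∑ (interval lo hi) (λ v → ∑ (decreasingVecs m lo (suc v)) (λ z → f (v ∷ z)))
  ∑-decreasingVecs-suc {m} lo hi f =
    trans (∑-concatMap (interval lo hi) _ f) (∑-cong (interval lo hi) (λ v _ → ∑-map (decreasingVecs m lo (suc v)) (v ∷_) f))

  DecreasingIn⇒All≥ : ∀ (x : Vec ℕ a) {lo hi} → DecreasingIn x lo hi → All (lo ≤_) x
  DecreasingIn⇒All≥ []      _               = []
  DecreasingIn⇒All≥ (u ∷ x) (lo≤u , _ , x↓) = lo≤u ∷ DecreasingIn⇒All≥ x x↓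

  All≥⇒*≤sum : ∀ (x : Vec ℕ a) {θ} → All (θ ≤_) x → a * θ ≤ sum x
  All≥⇒*≤sum []      []           = z≤n
  All≥⇒*≤sum (u ∷ x) (θ≤u ∷ θ≤x) = +-mono-≤ θ≤u (All≥⇒*≤sum x θ≤x)

  ∑-decreasingVecs : ∀ q a lo M → ∑ (decreasingVecs a lo (lo + suc M)) (λ u → q ^ (sum u ∸ a * lo)) ≡ qbinom q (a + M) M
  ∑-decreasingVecs q zero    lo M = sym (qbinom-diag q M)
  ∑-decreasingVecs q (suc a) lo M = begin
    ∑ (concatMap tails (applyDownFrom (lo +_) ((lo + suc M) ∸ lo))) weight
      ≡⟨ cong (λ k → ∑ (concatMap tails (applyDownFrom (lo +_) k)) weight) (m+n∸m≡n lo (suc M)) ⟩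
    ∑ (concatMap tails (applyDownFrom (lo +_) (suc M))) weight           ≡⟨ ∑-concatMap (applyDownFrom (lo +_) (suc M)) tails weight ⟩
    ∑ (applyDownFrom (lo +_) (suc M)) (λ u → ∑ (tails u) weight)         ≡⟨ pascal M ⟩
    qbinom q (suc a + M) M                                               ∎
    where
    tails : ℕ → List (Vec ℕ (suc a))
    tails u = map (u ∷_) (decreasingVecs a lo (suc u))
    weight : Vec ℕ (suc a) → ℕ
    weight u = q ^ (sum u ∸ suc a * lo)
    head-factor : ∀ M′ s → a * lo ≤ s → q ^ ((lo + M′ + s) ∸ (suc a * lo)) ≡ q ^ M′ * q ^ (s ∸ a * lo)
    head-factor M′ s a*lo≤s = begin
      q ^ ((lo + M′ + s) ∸ (lo + a * lo)) ≡⟨ cong (λ z → q ^ (z ∸ (lo + a * lo))) (+-assoc lo M′ s) ⟩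
      q ^ ((lo + (M′ + s)) ∸ (lo + a * lo)) ≡⟨ cong (q ^_) ([m+n]∸[m+o]≡n∸o lo (M′ + s) (a * lo)) ⟩
      q ^ ((M′ + s) ∸ a * lo)             ≡⟨ cong (q ^_) (+-∸-assoc M′ a*lo≤s) ⟩
      q ^ (M′ + (s ∸ a * lo))             ≡⟨ ^-distribˡ-+-* q M′ _ ⟩
      q ^ M′ * q ^ (s ∸ a * lo)           ∎
    with-head : ∀ M′ → ∑ (tails (lo + M′)) weight ≡ q ^ M′ * qbinom q (a + M′) M′
    with-head M′ = begin
      ∑ (tails (lo + M′)) weight ≡⟨ ∑-map (decreasingVecs a lo (suc (lo + M′))) ((lo + M′) ∷_) weight ⟩
      ∑ (decreasingVecs a lo (suc (lo + M′))) (λ u → q ^ ((lo + M′ + sum u) ∸ suc a * lo))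
        ≡⟨ ∑-cong (decreasingVecs a lo _)
             (λ u u∈ → head-factor M′ (sum u) (All≥⇒*≤sum u (DecreasingIn⇒All≥ u (∈-decreasingVecs⁻ a lo _ u∈)))) ⟩
      ∑ (decreasingVecs a lo (suc (lo + M′))) (λ u → q ^ M′ * q ^ (sum u ∸ a * lo)) ≡⟨ ∑-*ˡ (decreasingVecs a lo _) (q ^ M′) _ ⟩
      q ^ M′ * ∑ (decreasingVecs a lo (suc (lo + M′))) (λ u → q ^ (sum u ∸ a * lo))
        ≡⟨ cong (λ hi → q ^ M′ * ∑ (decreasingVecs a lo hi) (λ u → q ^ (sum u ∸ a * lo))) (+-suc lo M′) ⟨
      q ^ M′ * ∑ (decreasingVecs a lo (lo + suc M′)) (λ u → q ^ (sum u ∸ a * lo)) ≡⟨ cong (q ^ M′ *_) (∑-decreasingVecs q a lo M′) ⟩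
      q ^ M′ * qbinom q (a + M′) M′ ∎
    pascal : ∀ M′ → ∑ (applyDownFrom (lo +_) (suc M′)) (λ u → ∑ (tails u) weight) ≡ qbinom q (suc a + M′) M′
    pascal zero     = trans (+-identityʳ _) (trans (with-head 0) (*-identityʳ _))
    pascal (suc M′) = begin
      ∑ (tails (lo + suc M′)) weight + ∑ (applyDownFrom (lo +_) (suc M′)) (λ u → ∑ (tails u) weight)
        ≡⟨ cong₂ _+_ (with-head (suc M′)) (pascal M′) ⟩
      q ^ suc M′ * qbinom q (a + suc M′) (suc M′) + qbinom q (suc a + M′) M′ ≡⟨ +-comm _ (qbinom q (suc a + M′) M′) ⟩
      qbinom q (suc a + M′) M′ + q ^ suc M′ * qbinom q (a + suc M′) (suc M′)
        ≡⟨ cong (λ z → qbinom q z M′ + q ^ suc M′ * qbinom q (a + suc M′) (suc M′)) (+-suc a M′) ⟨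
      qbinom q (a + suc M′) M′ + q ^ suc M′ * qbinom q (a + suc M′) (suc M′) ∎

  DecreasingIn-lookup : ∀ (z : Vec ℕ m) {lo hi} → DecreasingIn z lo hi → (j : Fin m) → lookup z j < hi
  DecreasingIn-lookup (u ∷ z) (_ , u<hi , _)  zero    = u<hi
  DecreasingIn-lookup (u ∷ z) (_ , u<hi , z↓) (suc j) = <-≤-trans (DecreasingIn-lookup z z↓ j) u<hi

  WeaklyDecreasing⇒DecreasingIn : ∀ (z : Vec ℕ m) {hi} → WeaklyDecreasing z → (∀ j → lookup z j < hi) → DecreasingIn z 0 hi
  WeaklyDecreasing⇒DecreasingIn []      _    _  = tt
  WeaklyDecreasing⇒DecreasingIn (u ∷ z) z↓ z<hi =
    z≤n , z<hi zero , WeaklyDecreasing⇒DecreasingIn z (λ i j i≤j → z↓ (suc i) (suc j) (s≤s i≤j)) (λ j → s≤s (z↓ zero (suc j) z≤n))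

  DecreasingIn⇒WeaklyDecreasing : ∀ (z : Vec ℕ m) {lo hi} → DecreasingIn z lo hi → WeaklyDecreasing z
  DecreasingIn⇒WeaklyDecreasing (u ∷ z) _            zero    zero    _         = ≤-refl
  DecreasingIn⇒WeaklyDecreasing (u ∷ z) (_ , _ , z↓) zero    (suc j) _         = ≤-pred (DecreasingIn-lookup z z↓ j)
  DecreasingIn⇒WeaklyDecreasing (u ∷ z) (_ , _ , z↓) (suc i) (suc j) (s≤s i≤j) = DecreasingIn⇒WeaklyDecreasing z z↓ i j i≤j

module Thresholds where

  open Sums
  open DecreasingVectors
  open import Data.Nat
  open import Data.Nat.Properties
  open import Data.Bool using (Bool; true; false; _∧_; if_then_else_; T)
  open import Data.Bool.Properties using (T-≡)
  open import Function.Bundles using (Equivalence)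
  open import Data.List using (List; []; _∷_)
  import Data.List as List
  open import Data.Fin using (Fin; zero; suc; toℕ)
  open import Data.Vec using (Vec; []; _∷_; _++_; sum; count; splitAt; lookup)
  open import Data.Vec.Properties using (sum-++; count≤n)
  open import Data.Vec.Relation.Unary.All using (All; []; _∷_)
  import Data.Vec.Relation.Unary.All as All
  open import Data.List.Membership.Propositional using (_∈_)
  open import Data.Product using (_×_; _,_; proj₁; proj₂)
  open import Data.Unit using (⊤; tt)
  open import Relation.Binary.PropositionalEquality
  open import Relation.Nullary using (yes; no; contradiction)
  open ≡-Reasoning

  private
    variable
      a m : ℕ

  T⇒≡true : ∀ {b} → T b → b ≡ true
  T⇒≡true = Equivalence.to T-≡

  ≡true⇒T : ∀ {b} → b ≡ true → T b
  ≡true⇒T = Equivalence.from T-≡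

  ≡ᵇ-refl : ∀ k → (k ≡ᵇ k) ≡ true
  ≡ᵇ-refl k = T⇒≡true (≡⇒≡ᵇ k k refl)

  countAtLeast : ℕ → Vec ℕ m → ℕ
  countAtLeast θ = count (θ ≤?_)

  countAtLeast-∷-≥ : ∀ {θ u} (z : Vec ℕ m) → θ ≤ u → countAtLeast θ (u ∷ z) ≡ suc (countAtLeast θ z)
  countAtLeast-∷-≥ z θ≤u rewrite T⇒≡true (≤⇒≤ᵇ θ≤u) = refl

  countAtLeast-∷-< : ∀ {θ u} (z : Vec ℕ m) → u < θ → countAtLeast θ (u ∷ z) ≡ countAtLeast θ z
  countAtLeast-∷-< {θ = θ} {u} z u<θ with θ ≤ᵇ u in θ≤ᵇu
  ... | true  = contradiction (≤ᵇ⇒≤ θ u (≡true⇒T θ≤ᵇu)) (<⇒≱ u<θ)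
  ... | false = refl

  countAtLeast-above : ∀ (x : Vec ℕ m) {lo hi θ} → DecreasingIn x lo hi → hi ≤ θ → countAtLeast θ x ≡ 0
  countAtLeast-above []      _                hi≤θ = refl
  countAtLeast-above (u ∷ x) (_ , u<hi , x↓) hi≤θ =
    trans (countAtLeast-∷-< x (<-≤-trans u<hi hi≤θ)) (countAtLeast-above x x↓ (<-≤-trans u<hi hi≤θ))

  countAtLeast-++ : ∀ {k} (u : Vec ℕ k) (z : Vec ℕ m) {θ} → All (θ ≤_) u → countAtLeast θ (u ++ z) ≡ k + countAtLeast θ z
  countAtLeast-++ []      z []           = refl
  countAtLeast-++ (v ∷ u) z (θ≤v ∷ θ≤u) = trans (countAtLeast-∷-≥ (u ++ z) θ≤v) (cong suc (countAtLeast-++ u z θ≤u))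

  countAtLeast≡0⇒DecreasingIn : ∀ (x : Vec ℕ m) {lo hi θ} → DecreasingIn x lo hi → countAtLeast θ x ≡ 0 → DecreasingIn x lo θ
  countAtLeast≡0⇒DecreasingIn []      _                 _   = tt
  countAtLeast≡0⇒DecreasingIn (v ∷ x) {θ = θ} (lo≤v , _ , x↓) c≡0 with θ ≤? v
  ... | yes θ≤v = contradiction (trans (sym (countAtLeast-∷-≥ x θ≤v)) c≡0) (λ ())
  ... | no θ≰v  = lo≤v , ≰⇒> θ≰v , x↓

  DecreasingIn-split : ∀ {k} (u : Vec ℕ k) (z : Vec ℕ m) {lo hi θ} → DecreasingIn (u ++ z) lo hi → countAtLeast θ (u ++ z) ≡ k →
    All (θ ≤_) u × DecreasingIn z lo θ
  DecreasingIn-split []      z x↓ c≡0 = [] , countAtLeast≡0⇒DecreasingIn z x↓ c≡0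
  DecreasingIn-split (v ∷ u) z {θ = θ} (_ , _ , x↓) c≡k with θ ≤? v
  ... | yes θ≤v with DecreasingIn-split u z x↓ (suc-injective (trans (sym (countAtLeast-∷-≥ (u ++ z) θ≤v)) c≡k))
  ...   | θ≤u , z↓ = (θ≤v ∷ θ≤u) , z↓
  DecreasingIn-split (v ∷ u) z {θ = θ} (_ , _ , x↓) c≡k | no θ≰v =
    contradiction (trans (sym (countAtLeast-above (u ++ z) x↓ (≰⇒> θ≰v))) (trans (sym (countAtLeast-∷-< (u ++ z) (≰⇒> θ≰v))) c≡k)) (λ ())

  countAtLeast-head< : ∀ {lo θ v} (z : Vec ℕ m) → v < θ → DecreasingIn z lo (suc v) → countAtLeast θ (v ∷ z) ≡ 0
  countAtLeast-head< z v<θ z↓ = trans (countAtLeast-∷-< z v<θ) (countAtLeast-above z z↓ v<θ)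

  ∑-countAtLeast≡0 : ∀ m {θ hi} → θ ≤ hi → (g : Vec ℕ m → ℕ) →
    ∑ (decreasingVecs m 0 hi) (λ x → if countAtLeast θ x ≡ᵇ 0 then g x else 0) ≡ ∑ (decreasingVecs m 0 θ) g
  ∑-countAtLeast≡0 zero    θ≤hi g = refl
  ∑-countAtLeast≡0 (suc m) {θ} {hi} θ≤hi g = begin
    ∑ (decreasingVecs (suc m) 0 hi) F        ≡⟨ ∑-decreasingVecs-suc 0 hi F ⟩
    ∑ (interval 0 hi) G                      ≡⟨ cong (λ vs → ∑ vs G) (interval-split θ≤hi) ⟩
    ∑ (interval θ hi List.++ interval 0 θ) G ≡⟨ ∑-++ (interval θ hi) (interval 0 θ) G ⟩
    ∑ (interval θ hi) G + ∑ (interval 0 θ) G ≡⟨ cong₂ _+_ (∑-zero (interval θ hi) high) (∑-cong (interval 0 θ) low) ⟩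
    ∑ (interval 0 θ) (λ v → ∑ (decreasingVecs m 0 (suc v)) (λ z → g (v ∷ z))) ≡⟨ ∑-decreasingVecs-suc 0 θ g ⟨
    ∑ (decreasingVecs (suc m) 0 θ) g         ∎
    where
    F : Vec ℕ (suc m) → ℕ
    F x = if countAtLeast θ x ≡ᵇ 0 then g x else 0
    G : ℕ → ℕ
    G v = ∑ (decreasingVecs m 0 (suc v)) (λ z → F (v ∷ z))
    high : ∀ v → v ∈ interval θ hi → G v ≡ 0
    high v v∈ = ∑-zero (decreasingVecs m 0 (suc v))
      (λ z _ → cong (λ c → if c ≡ᵇ 0 then g (v ∷ z) else 0) (countAtLeast-∷-≥ z (proj₁ (∈-interval⁻ v∈))))
    low : ∀ v → v ∈ interval 0 θ → G v ≡ ∑ (decreasingVecs m 0 (suc v)) (λ z → g (v ∷ z))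
    low v v∈ = ∑-cong (decreasingVecs m 0 (suc v)) (λ z z∈ → cong (λ c → if c ≡ᵇ 0 then g (v ∷ z) else 0)
      (countAtLeast-head< z (proj₂ (∈-interval⁻ v∈)) (∈-decreasingVecs⁻ m 0 (suc v) z∈)))

  ∑-countAtLeast≡ : ∀ a m′ {θ hi} → θ ≤ hi → (g : Vec ℕ (a + m′) → ℕ) →
    ∑ (decreasingVecs (a + m′) 0 hi) (λ x → if countAtLeast θ x ≡ᵇ a then g x else 0)
    ≡ ∑ (decreasingVecs a θ hi) (λ u → ∑ (decreasingVecs m′ 0 θ) (λ z → g (u ++ z)))
  ∑-countAtLeast≡ zero    m′ θ≤hi g = trans (∑-countAtLeast≡0 m′ θ≤hi g) (sym (+-identityʳ _))
  ∑-countAtLeast≡ (suc a) m′ {θ} {hi} θ≤hi g = begin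
    ∑ (decreasingVecs (suc a + m′) 0 hi) F   ≡⟨ ∑-decreasingVecs-suc 0 hi F ⟩
    ∑ (interval 0 hi) G                      ≡⟨ cong (λ vs → ∑ vs G) (interval-split θ≤hi) ⟩
    ∑ (interval θ hi List.++ interval 0 θ) G ≡⟨ ∑-++ (interval θ hi) (interval 0 θ) G ⟩
    ∑ (interval θ hi) G + ∑ (interval 0 θ) G ≡⟨ cong₂ _+_ (∑-cong (interval θ hi) high) (∑-zero (interval 0 θ) low) ⟩
    ∑ (interval θ hi) (λ v → ∑ (decreasingVecs a θ (suc v)) (λ u → ∑ (decreasingVecs m′ 0 θ) (λ z → g (v ∷ (u ++ z))))) + 0
      ≡⟨ +-identityʳ _ ⟩
    ∑ (interval θ hi) (λ v → ∑ (decreasingVecs a θ (suc v)) (λ u → ∑ (decreasingVecs m′ 0 θ) (λ z → g (v ∷ (u ++ z)))))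
      ≡⟨ ∑-decreasingVecs-suc θ hi (λ u → ∑ (decreasingVecs m′ 0 θ) (λ z → g (u ++ z))) ⟨
    ∑ (decreasingVecs (suc a) θ hi) (λ u → ∑ (decreasingVecs m′ 0 θ) (λ z → g (u ++ z))) ∎
    where
    F : Vec ℕ (suc a + m′) → ℕ
    F x = if countAtLeast θ x ≡ᵇ suc a then g x else 0
    G : ℕ → ℕ
    G v = ∑ (decreasingVecs (a + m′) 0 (suc v)) (λ z → F (v ∷ z))
    high : ∀ v → v ∈ interval θ hi →
      G v ≡ ∑ (decreasingVecs a θ (suc v)) (λ u → ∑ (decreasingVecs m′ 0 θ) (λ z → g (v ∷ (u ++ z))))
    high v v∈ = trans
      (∑-cong (decreasingVecs (a + m′) 0 (suc v)) (λ z _ → cong (λ c → if c ≡ᵇ suc a then g (v ∷ z) else 0) (countAtLeast-∷-≥ z θ≤v)))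
      (∑-countAtLeast≡ a m′ (≤-trans θ≤v (n≤1+n v)) (λ x → g (v ∷ x)))
      where
      θ≤v = proj₁ (∈-interval⁻ v∈)
    low : ∀ v → v ∈ interval 0 θ → G v ≡ 0
    low v v∈ = ∑-zero (decreasingVecs (a + m′) 0 (suc v)) (λ z z∈ → cong (λ c → if c ≡ᵇ suc a then g (v ∷ z) else 0)
      (countAtLeast-head< z (proj₂ (∈-interval⁻ v∈)) (∈-decreasingVecs⁻ (a + m′) 0 (suc v) z∈)))

  countsMatch : ℕ → List (ℕ × ℕ) → Vec ℕ m → Bool
  countsMatch off []             x = true
  countsMatch off ((θ , a) ∷ cs) x = (countAtLeast θ x ≡ᵇ off + a) ∧ countsMatch (off + a) cs x

  groupTotal : List (ℕ × ℕ) → ℕ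
  groupTotal []             = 0
  groupTotal ((θ , a) ∷ cs) = a + groupTotal cs

  floorSum : List (ℕ × ℕ) → ℕ
  floorSum []             = 0
  floorSum ((θ , a) ∷ cs) = a * θ + floorSum cs

  ThresholdsBelow : ℕ → List (ℕ × ℕ) → Set
  ThresholdsBelow hi []             = ⊤
  ThresholdsBelow hi ((θ , a) ∷ cs) = θ ≤ hi × ThresholdsBelow θ cs

  groupsGF : ℕ → ℕ → List (ℕ × ℕ) → ℕ
  groupsGF q hi []             = 1
  groupsGF q hi ((θ , a) ∷ cs) = ∑ (decreasingVecs a θ hi) (λ u → q ^ (sum u ∸ a * θ)) * groupsGF q θ cs

  +-cancelˡ-≡ᵇ : ∀ k c e → (k + c ≡ᵇ k + e) ≡ (c ≡ᵇ e)
  +-cancelˡ-≡ᵇ zero    c e = refl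
  +-cancelˡ-≡ᵇ (suc k) c e = +-cancelˡ-≡ᵇ k c e

  countsMatch-++ : ∀ cs {k} (u : Vec ℕ k) (z : Vec ℕ m) {θ₀} off → All (θ₀ ≤_) u → ThresholdsBelow θ₀ cs →
    countsMatch (k + off) cs (u ++ z) ≡ countsMatch off cs z
  countsMatch-++ []             u z off θ₀≤u _             = refl
  countsMatch-++ ((θ , a) ∷ cs) {k} u z off θ₀≤u (θ≤θ₀ , cs↓) =
    cong₂ _∧_ (trans (cong₂ _≡ᵇ_ (countAtLeast-++ u z θ≤u) (+-assoc k off a)) (+-cancelˡ-≡ᵇ k (countAtLeast θ z) (off + a)))
              (trans (cong (λ o → countsMatch o cs (u ++ z)) (+-assoc k off a)) (countsMatch-++ cs u z (off + a) θ≤u cs↓))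
    where
    θ≤u = All.map (≤-trans θ≤θ₀) θ₀≤u

  countsMatch-++₀ : ∀ cs {k} (u : Vec ℕ k) (z : Vec ℕ m) {θ₀} → All (θ₀ ≤_) u → ThresholdsBelow θ₀ cs →
    countsMatch k cs (u ++ z) ≡ countsMatch 0 cs z
  countsMatch-++₀ cs {k} u z θ₀≤u cs↓ = trans (cong (λ o → countsMatch o cs (u ++ z)) (sym (+-identityʳ k))) (countsMatch-++ cs u z 0 θ₀≤u cs↓)

  countsMatch⇒floorSum≤sum : ∀ cs {hi m} → m ≡ groupTotal cs → (z : Vec ℕ m) → ThresholdsBelow hi cs → DecreasingIn z 0 hi →
    countsMatch 0 cs z ≡ true → floorSum cs ≤ sum z
  countsMatch⇒floorSum≤sum []             refl z _         _  _ = z≤n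
  countsMatch⇒floorSum≤sum ((θ , a) ∷ cs) refl z (_ , cs↓) z↓ match with splitAt a z
  ... | u , z′ , refl with countAtLeast θ (u ++ z′) ≡ᵇ a in count≡a | match
  ... | true | match′ with DecreasingIn-split u z′ z↓ (≡ᵇ⇒≡ _ _ (≡true⇒T count≡a))
  ... | θ≤u , z′↓ = ≤-trans (+-mono-≤ (All≥⇒*≤sum u θ≤u)
                                (countsMatch⇒floorSum≤sum cs refl z′ cs↓ z′↓ (trans (sym (countsMatch-++₀ cs u z′ θ≤u cs↓)) match′)))
                            (≤-reflexive (sym (sum-++ u)))

  private
    if-∧ : ∀ a b (k : ℕ) → (if a ∧ b then k else 0) ≡ (if a then (if b then k else 0) else 0)
    if-∧ true  b k = refl
    if-∧ false b k = refl

    ^-∸-split : ∀ q s t e f → e ≤ s → f ≤ t → q ^ ((s + t) ∸ (e + f)) ≡ q ^ (s ∸ e) * q ^ (t ∸ f)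
    ^-∸-split q s t e f e≤s f≤t = trans (cong (q ^_) exponent) (^-distribˡ-+-* q (s ∸ e) (t ∸ f))
      where
      exponent : (s + t) ∸ (e + f) ≡ (s ∸ e) + (t ∸ f)
      exponent = begin
        (s + t) ∸ (e + f) ≡⟨ ∸-+-assoc (s + t) e f ⟨
        (s + t) ∸ e ∸ f   ≡⟨ cong (_∸ f) (+-∸-comm t e≤s) ⟩
        (s ∸ e) + t ∸ f   ≡⟨ +-∸-assoc (s ∸ e) f≤t ⟩
        (s ∸ e) + (t ∸ f) ∎

  ∑-countsMatch : ∀ q cs {hi m} → m ≡ groupTotal cs → ThresholdsBelow hi cs →
    ∑ (decreasingVecs m 0 hi) (λ x → if countsMatch 0 cs x then q ^ (sum x ∸ floorSum cs) else 0) ≡ groupsGF q hi cs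
  ∑-countsMatch q []             refl _              = refl
  ∑-countsMatch q ((θ , a) ∷ cs) {hi} refl (θ≤hi , cs↓) = begin
    ∑ (decreasingVecs (a + groupTotal cs) 0 hi)
      (λ x → if (countAtLeast θ x ≡ᵇ a) ∧ countsMatch a cs x then q ^ (sum x ∸ (a * θ + floorSum cs)) else 0)
      ≡⟨ ∑-cong (decreasingVecs (a + groupTotal cs) 0 hi) (λ x _ → if-∧ (countAtLeast θ x ≡ᵇ a) (countsMatch a cs x) _) ⟩
    ∑ (decreasingVecs (a + groupTotal cs) 0 hi) (λ x → if countAtLeast θ x ≡ᵇ a then g x else 0)
      ≡⟨ ∑-countAtLeast≡ a (groupTotal cs) θ≤hi g ⟩
    ∑ (decreasingVecs a θ hi) (λ u → ∑ Z (λ z → g (u ++ z)))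
      ≡⟨ ∑-cong (decreasingVecs a θ hi)
           (λ u u∈ → trans (∑-cong Z (λ z z∈ → split u z (DecreasingIn⇒All≥ u (∈-decreasingVecs⁻ a θ hi u∈))
                                                                                    (∈-decreasingVecs⁻ (groupTotal cs) 0 θ z∈)))
                                                       (∑-*ˡ Z (q ^ (sum u ∸ a * θ)) rest)) ⟩
    ∑ (decreasingVecs a θ hi) (λ u → q ^ (sum u ∸ a * θ) * ∑ Z rest)
      ≡⟨ ∑-*ʳ (decreasingVecs a θ hi) (∑ Z rest) (λ u → q ^ (sum u ∸ a * θ)) ⟩
    ∑ (decreasingVecs a θ hi) (λ u → q ^ (sum u ∸ a * θ)) * ∑ Z rest
      ≡⟨ cong (∑ (decreasingVecs a θ hi) (λ u → q ^ (sum u ∸ a * θ)) *_) (∑-countsMatch q cs refl cs↓) ⟩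
    groupsGF q hi ((θ , a) ∷ cs) ∎
    where
    Z = decreasingVecs (groupTotal cs) 0 θ
    g : Vec ℕ (a + groupTotal cs) → ℕ
    g x = if countsMatch a cs x then q ^ (sum x ∸ (a * θ + floorSum cs)) else 0
    rest : Vec ℕ (groupTotal cs) → ℕ
    rest z = if countsMatch 0 cs z then q ^ (sum z ∸ floorSum cs) else 0
    split : (u : Vec ℕ a) (z : Vec ℕ (groupTotal cs)) → All (θ ≤_) u → DecreasingIn z 0 θ → g (u ++ z) ≡ q ^ (sum u ∸ a * θ) * rest z
    split u z θ≤u z↓ rewrite countsMatch-++₀ cs u z θ≤u cs↓ | sum-++ {ys = z} u with countsMatch 0 cs z in match
    ... | true  = ^-∸-split q (sum u) (sum z) (a * θ) (floorSum cs) (All≥⇒*≤sum u θ≤u) (countsMatch⇒floorSum≤sum cs refl z cs↓ z↓ match)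
    ... | false = sym (*-zeroʳ (q ^ (sum u ∸ a * θ)))

  countAtLeast-antitone : ∀ (z : Vec ℕ m) {θ θ′} → θ ≤ θ′ → countAtLeast θ′ z ≤ countAtLeast θ z
  countAtLeast-antitone []      θ≤θ′ = z≤n
  countAtLeast-antitone (u ∷ z) {θ} {θ′} θ≤θ′ with θ′ ≤? u | θ ≤? u
  ... | yes θ′≤u | _       rewrite countAtLeast-∷-≥ z θ′≤u | countAtLeast-∷-≥ z (≤-trans θ≤θ′ θ′≤u) =
    s≤s (countAtLeast-antitone z θ≤θ′)
  ... | no θ′≰u  | yes θ≤u rewrite countAtLeast-∷-< z (≰⇒> θ′≰u) | countAtLeast-∷-≥ z θ≤u =
    m≤n⇒m≤1+n (countAtLeast-antitone z θ≤θ′)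
  ... | no θ′≰u  | no θ≰u  rewrite countAtLeast-∷-< z (≰⇒> θ′≰u) | countAtLeast-∷-< z (≰⇒> θ≰u) =
    countAtLeast-antitone z θ≤θ′

  countAtLeast≤length : ∀ θ (z : Vec ℕ m) → countAtLeast θ z ≤ m
  countAtLeast≤length θ = count≤n (θ ≤?_)

  countAtLeast-0 : ∀ (z : Vec ℕ m) → countAtLeast 0 z ≡ m
  countAtLeast-0 []      = refl
  countAtLeast-0 (u ∷ z) = cong suc (countAtLeast-0 z)

  lookup-countAtLeast : ∀ (z : Vec ℕ m) {lo hi} θ → DecreasingIn z lo hi → (j : Fin m) →
    (θ ≤ᵇ lookup z j) ≡ (toℕ j <ᵇ countAtLeast θ z)
  lookup-countAtLeast (u ∷ z) θ (_ , _ , z↓) j with θ ≤? u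
  lookup-countAtLeast (u ∷ z) θ (_ , _ , z↓) zero    | yes θ≤u rewrite countAtLeast-∷-≥ z θ≤u = T⇒≡true (≤⇒≤ᵇ θ≤u)
  lookup-countAtLeast (u ∷ z) θ (_ , _ , z↓) (suc j) | yes θ≤u rewrite countAtLeast-∷-≥ z θ≤u = lookup-countAtLeast z θ z↓ j
  lookup-countAtLeast (u ∷ z) θ (_ , _ , z↓) j       | no θ≰u
    rewrite countAtLeast-∷-< z (≰⇒> θ≰u) | countAtLeast-above z z↓ (≰⇒> θ≰u) = ≤ᵇ-false (lookup≤head j)
    where
    lookup≤head : ∀ j → lookup (u ∷ z) j < θ
    lookup≤head zero    = ≰⇒> θ≰u
    lookup≤head (suc j) = <-≤-trans (DecreasingIn-lookup z z↓ j) (≰⇒> θ≰u)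
    ≤ᵇ-false : ∀ {v} → v < θ → (θ ≤ᵇ v) ≡ false
    ≤ᵇ-false {v} v<θ with θ ≤ᵇ v in θ≤ᵇv
    ... | true  = contradiction (≤ᵇ⇒≤ θ v (≡true⇒T θ≤ᵇv)) (<⇒≱ v<θ)
    ... | false = refl

module AbstractITC where

  open Sums
  open DecreasingVectors
  open Thresholds
  open import Data.Nat
  open import Data.Nat.Properties
  open import Data.Bool using (Bool; true; false; _∧_; if_then_else_)
  open import Data.List using (List; []; _∷_; length)
  open import Data.Vec using (Vec)
  open import Data.Product using (_×_; _,_; proj₁; proj₂)
  open import Data.Product.Properties using (,-injectiveˡ; ,-injectiveʳ)
  open import Data.Sum using (_⊎_; inj₁; inj₂)
  open import Data.Unit using (⊤; tt)
  open import Relation.Binary.PropositionalEquality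
  open import Relation.Nullary using (yes; no; contradiction)

  module Rounds (n d : ℕ) where

    totalQ totalP : List (ℕ × ℕ) → ℕ
    totalQ []             = 0
    totalQ ((b , a) ∷ s) = b + totalQ s
    totalP []             = 0
    totalP ((b , a) ∷ s) = a + totalP s

    -- A round (b, a) entered with A clique and B independent vertices toppled topples exactly the
    -- clique vertices with x_i ≥ n + d − (A + B + b + 1) and the independent ones with y_j ≥ n − A.
    vThresholds : ℕ → ℕ → List (ℕ × ℕ) → List (ℕ × ℕ)
    vThresholds A B []            = []
    vThresholds A B ((b , a) ∷ s) = ((n + d) ∸ suc (A + (B + b)) , a) ∷ vThresholds (A + a) (B + b) s

    wThresholds : ℕ → ℕ → List (ℕ × ℕ) → List (ℕ × ℕ)
    wThresholds A B []            = []
    wThresholds A B ((b , a) ∷ s) = (n ∸ A , b) ∷ wThresholds (A + a) (B + b) s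

    groupTotal-vThresholds : ∀ A B s → groupTotal (vThresholds A B s) ≡ totalP s
    groupTotal-vThresholds A B []            = refl
    groupTotal-vThresholds A B ((b , a) ∷ s) = cong (a +_) (groupTotal-vThresholds (A + a) (B + b) s)

    groupTotal-wThresholds : ∀ A B s → groupTotal (wThresholds A B s) ≡ totalQ s
    groupTotal-wThresholds A B []            = refl
    groupTotal-wThresholds A B ((b , a) ∷ s) = cong (b +_) (groupTotal-wThresholds (A + a) (B + b) s)

    PositiveBeforeLast : List (ℕ × ℕ) → Set
    PositiveBeforeLast []            = ⊤
    PositiveBeforeLast ((b , a) ∷ s) = (s ≡ [] ⊎ 1 ≤ a) × PositiveBeforeLast s

  module Run (n d : ℕ) (x : Vec ℕ n) (y : Vec ℕ d) where

    open Rounds n d public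

    -- Once the sink, v₀ … v_{α−1} and w₀ … w_{β−1} have toppled, an untoppled w_j holds y_j + α + 1 and an
    -- untoppled v_i holds x_i + α + β + 1. So reachedW α and reachedV α β count the independent and the
    -- clique vertices that are unstable or already toppled, and as x and y decrease these are prefixes.
    reachedW : ℕ → ℕ
    reachedW α = countAtLeast (n ∸ α) y

    reachedV : ℕ → ℕ → ℕ
    reachedV α β = countAtLeast ((n + d) ∸ suc (α + β)) x

    -- For BelowReach α β, (reachedV α β ∸ α) + (reachedW α ∸ β) is the number of unstable vertices.
    settled : ℕ → ℕ → Bool
    settled α β = ((reachedV α β ∸ α) + (reachedW α ∸ β)) ≡ᵇ 0

    run : ℕ → ℕ → ℕ → List (ℕ × ℕ)
    run zero    α β = []
    run (suc f) α β = (reachedW α ∸ β , reachedV α (reachedW α) ∸ α) ∷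
      (if settled (reachedV α (reachedW α)) (reachedW α) then [] else run f (reachedV α (reachedW α)) (reachedW α))

    runEnd : ℕ → ℕ → ℕ → ℕ × ℕ
    runEnd zero    α β = α , β
    runEnd (suc f) α β =
      if settled (reachedV α (reachedW α)) (reachedW α) then (reachedV α (reachedW α) , reachedW α) else runEnd f (reachedV α (reachedW α)) (reachedW α)

    reachedW-mono : ∀ {α α′} → α ≤ α′ → reachedW α ≤ reachedW α′
    reachedW-mono α≤α′ = countAtLeast-antitone y (∸-monoʳ-≤ n α≤α′)

    reachedV-mono : ∀ {α α′ β β′} → α ≤ α′ → β ≤ β′ → reachedV α β ≤ reachedV α′ β′
    reachedV-mono α≤α′ β≤β′ = countAtLeast-antitone x (∸-monoʳ-≤ (n + d) (s≤s (+-mono-≤ α≤α′ β≤β′)))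

    reachedV≤n : ∀ α β → reachedV α β ≤ n
    reachedV≤n α β = countAtLeast≤length _ x

    reachedW≤d : ∀ α → reachedW α ≤ d
    reachedW≤d α = countAtLeast≤length _ y

    settled⇒ : ∀ α β → settled α β ≡ true → reachedV α β ≤ α × reachedW α ≤ β
    settled⇒ α β eq with ≡ᵇ⇒≡ _ 0 (≡true⇒T eq)
    ... | sum≡0 = m∸n≡0⇒m≤n (m+n≡0⇒m≡0 _ sum≡0) , m∸n≡0⇒m≤n (m+n≡0⇒n≡0 (reachedV α β ∸ α) sum≡0)

    ⇒settled : ∀ α β → reachedV α β ≤ α → reachedW α ≤ β → settled α β ≡ true
    ⇒settled α β v≤α w≤β rewrite m≤n⇒m∸n≡0 v≤α | m≤n⇒m∸n≡0 w≤β = refl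

    settled-n-d : settled n d ≡ true
    settled-n-d = ⇒settled n d (reachedV≤n n d) (≤-reflexive (trans (cong (λ θ → countAtLeast θ y) (n∸n≡0 n)) (countAtLeast-0 y)))

    BelowReach : ℕ → ℕ → Set
    BelowReach α β = β ≤ reachedW α × α ≤ reachedV α β

    BelowReach-0 : BelowReach 0 0
    BelowReach-0 = z≤n , z≤n

    step-≥ : ∀ {α β} → BelowReach α β → α ≤ reachedV α (reachedW α) × β ≤ reachedW α
    step-≥ (β≤w , α≤v) = ≤-trans α≤v (reachedV-mono ≤-refl β≤w) , β≤w

    BelowReach-step : ∀ {α β} → BelowReach α β → BelowReach (reachedV α (reachedW α)) (reachedW α)
    BelowReach-step below with step-≥ below
    ... | α≤α′ , _ = reachedW-mono α≤α′ , reachedV-mono α≤α′ ≤-refl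

    BelowReach⇒α≤n : ∀ {α β} → BelowReach α β → α ≤ n
    BelowReach⇒α≤n {α} {β} (_ , α≤v) = ≤-trans α≤v (reachedV≤n α β)

    BelowReach⇒β≤d : ∀ {α β} → BelowReach α β → β ≤ d
    BelowReach⇒β≤d {α} (β≤w , _) = ≤-trans β≤w (reachedW≤d α)

    step-grows : ∀ {α β} → BelowReach α β → settled (reachedV α (reachedW α)) (reachedW α) ≡ false → α < reachedV α (reachedW α)
    step-grows {α} below not-settled with α <? reachedV α (reachedW α)
    ... | yes α<α′ = α<α′
    ... | no α≮α′  = contradiction (trans (sym fixed-settled) not-settled) (λ ())
      where
      α′≡α : reachedV α (reachedW α) ≡ α
      α′≡α = ≤-antisym (≮⇒≥ α≮α′) (proj₁ (step-≥ below))
      fixed-settled : settled (reachedV α (reachedW α)) (reachedW α) ≡ true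
      fixed-settled = ⇒settled _ _ (≤-reflexive (cong (λ t → reachedV t (reachedW α)) α′≡α)) (≤-reflexive (cong reachedW α′≡α))

    runEnd-settled : ∀ f α β → BelowReach α β → n ∸ α ≤ f →
      settled (proj₁ (runEnd (suc f) α β)) (proj₂ (runEnd (suc f) α β)) ≡ true
    runEnd-settled f α β below fuel with settled (reachedV α (reachedW α)) (reachedW α) in settled?
    ... | true  = settled?
    runEnd-settled zero    α β below fuel | false =
      contradiction (≤-trans (step-grows below settled?) (reachedV≤n α _)) (≤⇒≯ (m∸n≡0⇒m≤n (n≤0⇒n≡0 fuel)))
    runEnd-settled (suc f) α β below fuel | false =
      runEnd-settled f _ _ (BelowReach-step below) (≤-pred (≤-trans (∸-monoʳ-< (step-grows below settled?) (reachedV≤n α _)) fuel))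

    runEnd-≤ : ∀ f {α β α₀ β₀} → reachedV α₀ β₀ ≤ α₀ → reachedW α₀ ≤ β₀ → α ≤ α₀ → β ≤ β₀ →
      proj₁ (runEnd f α β) ≤ α₀ × proj₂ (runEnd f α β) ≤ β₀
    runEnd-≤ zero    v≤α₀ w≤β₀ α≤α₀ β≤β₀ = α≤α₀ , β≤β₀
    runEnd-≤ (suc f) {α} v≤α₀ w≤β₀ α≤α₀ β≤β₀ with settled (reachedV α (reachedW α)) (reachedW α)
    ... | true  = α′≤α₀ , β′≤β₀
      where
      β′≤β₀ = ≤-trans (reachedW-mono α≤α₀) w≤β₀
      α′≤α₀ = ≤-trans (reachedV-mono α≤α₀ β′≤β₀) v≤α₀
    ... | false = runEnd-≤ f v≤α₀ w≤β₀ α′≤α₀ β′≤β₀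
      where
      β′≤β₀ = ≤-trans (reachedW-mono α≤α₀) w≤β₀
      α′≤α₀ = ≤-trans (reachedV-mono α≤α₀ β′≤β₀) v≤α₀

    runEnd-BelowReach : ∀ f α β → BelowReach α β → BelowReach (proj₁ (runEnd f α β)) (proj₂ (runEnd f α β))
    runEnd-BelowReach zero    α β below = below
    runEnd-BelowReach (suc f) α β below with settled (reachedV α (reachedW α)) (reachedW α)
    ... | true  = BelowReach-step below
    ... | false = runEnd-BelowReach f _ _ (BelowReach-step below)

    run-countsMatch : ∀ f α β → BelowReach α β →
      countsMatch α (vThresholds α β (run f α β)) x ≡ true × countsMatch β (wThresholds α β (run f α β)) y ≡ true
    run-countsMatch zero    α β below = refl , refl
    run-countsMatch (suc f) α β below
      rewrite m+[n∸m]≡n (proj₂ (step-≥ below)) | m+[n∸m]≡n (proj₁ (step-≥ below))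
            | ≡ᵇ-refl (reachedV α (reachedW α)) | ≡ᵇ-refl (reachedW α)
      with settled (reachedV α (reachedW α)) (reachedW α)
    ... | true  = refl , refl
    ... | false = run-countsMatch f _ _ (BelowReach-step below)

    run-totals : ∀ f α β → BelowReach α β → (α + totalP (run f α β) , β + totalQ (run f α β)) ≡ runEnd f α β
    run-totals zero    α β below = cong₂ _,_ (+-identityʳ α) (+-identityʳ β)
    run-totals (suc f) α β below with step-≥ below
    ... | α≤α′ , β≤β′ with settled (reachedV α (reachedW α)) (reachedW α)
    ... | true  = cong₂ _,_ (trans (cong (α +_) (+-identityʳ _)) (m+[n∸m]≡n α≤α′))
                           (trans (cong (β +_) (+-identityʳ _)) (m+[n∸m]≡n β≤β′))
    ... | false = trans (cong₂ _,_ (trans (sym (+-assoc α _ _)) (cong (_+ totalP rest) (m+[n∸m]≡n α≤α′)))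
                                   (trans (sym (+-assoc β _ _)) (cong (_+ totalQ rest) (m+[n∸m]≡n β≤β′))))
                        (run-totals f _ _ (BelowReach-step below))
      where
      rest = run f (reachedV α (reachedW α)) (reachedW α)

    run-positive : ∀ f α β → BelowReach α β → PositiveBeforeLast (run f α β)
    run-positive zero    α β below = tt
    run-positive (suc f) α β below with settled (reachedV α (reachedW α)) (reachedW α) in settled?
    ... | true  = inj₁ refl , tt
    ... | false = inj₂ (m<n⇒0<n∸m (step-grows below settled?)) , run-positive f _ _ (BelowReach-step below)

    run-length : ∀ f α β → BelowReach α β → length (run f α β) ≤ suc (n ∸ α)
    run-length zero    α β below = z≤n
    run-length (suc f) α β below with settled (reachedV α (reachedW α)) (reachedW α) in settled?
    ... | true  = s≤s z≤n
    ... | false = s≤s (≤-trans (run-length f _ _ (BelowReach-step below))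
                               (∸-monoʳ-< (step-grows below settled?) (BelowReach⇒α≤n (BelowReach-step below))))

  module RunAgreement (n d : ℕ) (x : Vec ℕ n) (y : Vec ℕ d) (x* : Vec ℕ n) (y* : Vec ℕ d) where

    module A = Run n d x y
    module B = Run n d x* y*
    open Rounds n d

    private
      ∧-true : ∀ {a b} → (a ∧ b) ≡ true → a ≡ true × b ≡ true
      ∧-true {true} {true} _ = refl , refl

      ≡ᵇ-true : ∀ {a b} → (a ≡ᵇ b) ≡ true → a ≡ b
      ≡ᵇ-true {a} {b} eq = ≡ᵇ⇒≡ a b (≡true⇒T eq)

    settled-transfer : ∀ {α β} → B.BelowReach α β → A.reachedW α ≡ B.reachedW α →
      A.reachedV α (B.reachedW α) ≡ B.reachedV α (B.reachedW α) → A.settled α β ≡ true → B.settled α β ≡ true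
    settled-transfer {α} {β} (β≤w , _) sameW sameV A-settled with A.settled⇒ α β A-settled
    ... | v≤α , w≤β = B.⇒settled α β (≤-trans (≤-reflexive sameVβ) v≤α) (≤-reflexive w≡β)
      where
      w≡β : B.reachedW α ≡ β
      w≡β = ≤-antisym (subst (_≤ β) sameW w≤β) β≤w
      sameVβ : B.reachedV α β ≡ A.reachedV α β
      sameVβ = trans (cong (B.reachedV α) (sym w≡β)) (trans (sym sameV) (cong (A.reachedV α) w≡β))

    first-round-agrees : ∀ f {α β} → B.BelowReach α β →
      countsMatch α (vThresholds α β (B.run (suc f) α β)) x ≡ true → countsMatch β (wThresholds α β (B.run (suc f) α β)) y ≡ true →
      A.reachedW α ≡ B.reachedW α × A.reachedV α (B.reachedW α) ≡ B.reachedV α (B.reachedW α)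
    first-round-agrees f {α} {β} below cx cy = sameW , sameV
      where
      β+ = m+[n∸m]≡n (proj₂ (B.step-≥ below))
      α+ = m+[n∸m]≡n (proj₁ (B.step-≥ below))
      sameW = trans (≡ᵇ-true (proj₁ (∧-true cy))) β+
      sameV = trans (cong (A.reachedV α) (sym β+)) (trans (≡ᵇ-true (proj₁ (∧-true cx))) α+)

    RunsAgree : ℕ → Set
    RunsAgree f = ∀ α β → B.BelowReach α β → B.runEnd f α β ≡ (n , d) →
      countsMatch α (vThresholds α β (B.run f α β)) x ≡ true → countsMatch β (wThresholds α β (B.run f α β)) y ≡ true →
      A.run f α β ≡ B.run f α β × A.runEnd f α β ≡ (n , d)

    runs-agree-after : ∀ f → RunsAgree f → ∀ α β → B.BelowReach α β → (if B.settled α β then (α , β) else B.runEnd f α β) ≡ (n , d) →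
      countsMatch α (vThresholds α β (if B.settled α β then [] else B.run f α β)) x ≡ true →
      countsMatch β (wThresholds α β (if B.settled α β then [] else B.run f α β)) y ≡ true →
      (if A.settled α β then [] else A.run f α β) ≡ (if B.settled α β then [] else B.run f α β) ×
      (if A.settled α β then (α , β) else A.runEnd f α β) ≡ (n , d)
    runs-agree-after f agree α β below end cx cy with B.settled α β in B-settled?
    ... | true with A.settled α β in A-settled?
    ...   | true  = refl , end
    ...   | false = contradiction (trans (sym (cong₂ A.settled (,-injectiveˡ end) (,-injectiveʳ end))) A-settled?)
                                  (λ eq → contradiction (trans (sym A.settled-n-d) eq) (λ ()))
    runs-agree-after zero    agree α β below end cx cy | false with A.settled α β
    ... | true  = refl , end
    ... | false = refl , end
    runs-agree-after (suc f) agree α β below end cx cy | false with A.settled α β in A-settled?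
    ... | false = agree α β below end cx cy
    ... | true  = contradiction (trans (sym B-settled?) (settled-transfer below sameW sameV A-settled?)) (λ ())
      where
      sameW = proj₁ (first-round-agrees f below cx cy)
      sameV = proj₂ (first-round-agrees f below cx cy)

    runs-agree : ∀ f → RunsAgree f
    runs-agree zero    α β below end cx cy = refl , end
    runs-agree (suc f) α β below end cx cy = conclude (trans (cong (A.reachedV α) sameW) sameV) sameW
      where
      β′ = B.reachedW α
      α′ = B.reachedV α β′
      tail = if B.settled α′ β′ then [] else B.run f α′ β′
      α+ = m+[n∸m]≡n (proj₁ (B.step-≥ below))
      β+ = m+[n∸m]≡n (proj₂ (B.step-≥ below))
      sameW = proj₁ (first-round-agrees f below cx cy)
      sameV = proj₂ (first-round-agrees f below cx cy)
      rest = runs-agree-after f (runs-agree f) α′ β′ (B.BelowReach-step below) end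
               (subst₂ (λ a b → countsMatch a (vThresholds a b tail) x ≡ true) α+ β+ (proj₂ (∧-true cx)))
               (subst₂ (λ a b → countsMatch b (wThresholds a b tail) y ≡ true) α+ β+ (proj₂ (∧-true cy)))
      conclude : ∀ {a b} → a ≡ α′ → b ≡ β′ →
        ((b ∸ β , a ∸ α) ∷ (if A.settled a b then [] else A.run f a b)) ≡ B.run (suc f) α β ×
        (if A.settled a b then (a , b) else A.runEnd f a b) ≡ (n , d)
      conclude refl refl = cong (_ ∷_) (proj₁ rest) , proj₂ rest

module Counting where

  open import Defs using (countB)
  open Thresholds using (≡true⇒T; ≡ᵇ-refl)
  open import Data.Nat as ℕ using (ℕ; zero; suc; _≤_; _<_; z≤n; s≤s; _<ᵇ_; _≡ᵇ_; _∸_; _+_)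
  import Data.Nat.Properties as ℕ
  open import Data.Fin as Fin using (Fin; toℕ)
  import Data.Fin.Properties as Fin
  open import Data.Bool using (Bool; true; false; _∧_; _∨_; not; if_then_else_)
  open import Data.Bool.Properties using (∧-identityʳ)
  open import Data.List using (List; []; _∷_; _++_; map; tabulate)
  open import Relation.Binary.PropositionalEquality
  open import Relation.Nullary using (does; yes; no; contradiction)

  private
    variable
      A B : Set

  countB-cong : ∀ {p p′ : A → Bool} (l : List A) → (∀ u → p u ≡ p′ u) → countB p l ≡ countB p′ l
  countB-cong []      p≗p′ = refl
  countB-cong {p′ = p′} (u ∷ l) p≗p′ rewrite p≗p′ u with p′ u
  ... | true  = cong suc (countB-cong l p≗p′)
  ... | false = countB-cong l p≗p′

  countB-++ : ∀ (p : A → Bool) l₁ l₂ → countB p (l₁ ++ l₂) ≡ countB p l₁ + countB p l₂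
  countB-++ p []       l₂ = refl
  countB-++ p (u ∷ l₁) l₂ with p u
  ... | true  = cong suc (countB-++ p l₁ l₂)
  ... | false = countB-++ p l₁ l₂

  countB-mono : ∀ {p p′ : A → Bool} (l : List A) → (∀ u → p u ≡ true → p′ u ≡ true) → countB p l ≤ countB p′ l
  countB-mono []      p⇒p′ = z≤n
  countB-mono {p = p} {p′} (u ∷ l) p⇒p′ with p u in pu | p′ u in p′u
  ... | true  | true  = s≤s (countB-mono l p⇒p′)
  ... | true  | false = contradiction (trans (sym (p⇒p′ u pu)) p′u) (λ ())
  ... | false | true  = ℕ.m≤n⇒m≤1+n (countB-mono l p⇒p′)
  ... | false | false = countB-mono l p⇒p′

  countB-∨ : ∀ (p q : A → Bool) (l : List A) → (∀ u → p u ≡ true → q u ≡ false) →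
    countB (λ u → p u ∨ q u) l ≡ countB p l + countB q l
  countB-∨ p q []      disjoint = refl
  countB-∨ p q (u ∷ l) disjoint with p u in pu | q u in qu
  ... | true  | true  = contradiction (trans (sym qu) (disjoint u pu)) (λ ())
  ... | true  | false = cong suc (countB-∨ p q l disjoint)
  ... | false | true  = trans (cong suc (countB-∨ p q l disjoint)) (sym (ℕ.+-suc _ _))
  ... | false | false = countB-∨ p q l disjoint

  countB-map : ∀ (p : B → Bool) (f : A → B) (l : List A) → countB p (map f l) ≡ countB (λ u → p (f u)) l
  countB-map p f []      = refl
  countB-map p f (u ∷ l) with p (f u)
  ... | true  = cong suc (countB-map p f l)
  ... | false = countB-map p f l

  countBelow : (ℕ → Bool) → ℕ → ℕ
  countBelow Q zero    = 0
  countBelow Q (suc m) = if Q 0 then suc (countBelow (λ j → Q (suc j)) m) else countBelow (λ j → Q (suc j)) m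

  countBelow-cong : ∀ {Q Q′} m → (∀ j → Q j ≡ Q′ j) → countBelow Q m ≡ countBelow Q′ m
  countBelow-cong zero    Q≗Q′ = refl
  countBelow-cong {Q′ = Q′} (suc m) Q≗Q′ rewrite Q≗Q′ 0 with Q′ 0
  ... | true  = cong suc (countBelow-cong m (λ j → Q≗Q′ (suc j)))
  ... | false = countBelow-cong m (λ j → Q≗Q′ (suc j))

  countB-tabulate : ∀ m (f : Fin m → A) (p : A → Bool) (Q : ℕ → Bool) → (∀ k → p (f k) ≡ Q (toℕ k)) →
    countB p (tabulate f) ≡ countBelow Q m
  countB-tabulate zero    f p Q p≗Q = refl
  countB-tabulate (suc m) f p Q p≗Q rewrite p≗Q Fin.zero with Q 0
  ... | true  = cong suc (countB-tabulate m (λ k → f (Fin.suc k)) p (λ j → Q (suc j)) (λ k → p≗Q (Fin.suc k)))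
  ... | false = countB-tabulate m (λ k → f (Fin.suc k)) p (λ j → Q (suc j)) (λ k → p≗Q (Fin.suc k))

  countBelow-false : ∀ m → countBelow (λ _ → false) m ≡ 0
  countBelow-false zero    = refl
  countBelow-false (suc m) = countBelow-false m

  countBelow-< : ∀ m {β} → β ≤ m → countBelow (λ j → j <ᵇ β) m ≡ β
  countBelow-< zero    z≤n     = refl
  countBelow-< (suc m) {zero} _ = countBelow-false (suc m)
  countBelow-< (suc m) {suc β} (s≤s β≤m) = cong suc (countBelow-< m β≤m)

  countBelow-range : ∀ m {b b′} → b ≤ b′ → b′ ≤ m → countBelow (λ j → not (j <ᵇ b) ∧ (j <ᵇ b′)) m ≡ b′ ∸ b
  countBelow-range m       {zero}  z≤n        b′≤m       = countBelow-< m b′≤m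
  countBelow-range (suc m) {suc b} (s≤s b≤b′) (s≤s b′≤m) = countBelow-range m b≤b′ b′≤m

  countBelow-<-≢-out : ∀ m {α ι} → α ≤ ι → α ≤ m → countBelow (λ j → (j <ᵇ α) ∧ not (j ≡ᵇ ι)) m ≡ α
  countBelow-<-≢-out m       {zero}  _          _          = countBelow-false m
  countBelow-<-≢-out (suc m) {suc α} {suc ι} (s≤s α≤ι) (s≤s α≤m) = cong suc (countBelow-<-≢-out m α≤ι α≤m)

  countBelow-<-≢-in : ∀ m {α ι} → ι < α → α ≤ m → suc (countBelow (λ j → (j <ᵇ α) ∧ not (j ≡ᵇ ι)) m) ≡ α
  countBelow-<-≢-in (suc m) {suc α} {zero}  _          (s≤s α≤m) =
    cong suc (trans (countBelow-cong m (λ j → ∧-identityʳ (j <ᵇ α))) (countBelow-< m α≤m))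
  countBelow-<-≢-in (suc m) {suc α} {suc ι} (s≤s ι<α) (s≤s α≤m) = cong suc (countBelow-<-≢-in m ι<α α≤m)

  ≢⇒≡ᵇ-false : ∀ {a b} → a ≢ b → (a ≡ᵇ b) ≡ false
  ≢⇒≡ᵇ-false {a} {b} a≢b with a ≡ᵇ b in a≡ᵇb
  ... | true  = contradiction (ℕ.≡ᵇ⇒≡ a b (≡true⇒T a≡ᵇb)) a≢b
  ... | false = refl

  does-Fin-≟ : ∀ {m} (k i : Fin m) → does (k Fin.≟ i) ≡ (toℕ k ≡ᵇ toℕ i)
  does-Fin-≟ k i with k Fin.≟ i
  ... | yes refl = sym (≡ᵇ-refl (toℕ k))
  ... | no k≢i   = sym (≢⇒≡ᵇ-false (λ eq → k≢i (Fin.toℕ-injective eq)))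

module Toppling where

  open import Defs
  open Counting
  open Sums using (unique-↭)
  open DecreasingVectors using (DecreasingIn; DecreasingIn-lookup)
  open Thresholds using (T⇒≡true; ≡true⇒T; lookup-countAtLeast)
  open import Data.Vec using (Vec; lookup)
  open import Data.Nat as ℕ using (ℕ; zero; suc; _≤_; _<_; z≤n; s≤s; _<ᵇ_; _≤ᵇ_; _≡ᵇ_; _∸_; _+_)
  import Data.Nat.Properties as ℕ
  open import Data.Integer as ℤ using (ℤ; +_)
  import Data.Integer.Properties as ℤ
  open import Data.Integer.Solver using (module +-*-Solver)
  open import Data.Fin as Fin using (Fin; toℕ)
  import Data.Fin.Properties as Fin
  open import Data.Bool using (Bool; true; false; _∧_; _∨_; not; if_then_else_)
  open import Data.Bool.Properties using (∧-distribʳ-∨; ∧-identityʳ; ∧-zeroʳ)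
  open import Data.List using (List; []; _∷_; _++_; map; allFin)
  open import Data.List.Membership.Propositional using (_∈_)
  open import Data.List.Relation.Unary.Any using (here; there)
  open import Data.List.Membership.Propositional.Properties using (∈-++⁺ˡ; ∈-++⁺ʳ; ∈-++⁻; ∈-map⁺; ∈-map⁻; ∈-allFin)
  open import Data.List.Relation.Unary.Unique.Propositional using (Unique)
  import Data.List.Relation.Unary.Unique.Propositional.Properties as Unique
  open import Data.List.Relation.Unary.AllPairs using ([]; _∷_)
  import Data.List.Relation.Unary.All as ListAll
  open import Data.Sum using (inj₁; inj₂)
  open import Data.List.Relation.Binary.Permutation.Propositional using (_↭_; ↭-sym; ↭⇒↭ₛ)
  open import Data.List.Relation.Binary.Permutation.Propositional.Properties using (∈-resp-↭)
  open import Data.Product using (_×_; _,_; proj₁; proj₂)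
  open import Data.Empty using (⊥)
  open import Data.Unit using (tt)
  open import Relation.Binary.PropositionalEquality
  open import Relation.Nullary using (¬_; does; yes; no; contradiction)

  module _ {n d : ℕ} where

    toppleSet-cong : (S S′ : Vtx n d → Bool) (c c′ : Config n d) → (∀ u → S u ≡ S′ u) → (∀ u → c u ≡ c′ u) →
      ∀ z → toppleSet S c z ≡ toppleSet S′ c′ z
    toppleSet-cong S S′ c c′ S≗S′ c≗c′ sink  = c≗c′ sink
    toppleSet-cong S S′ c c′ S≗S′ c≗c′ (v i) =
      cong₂ ℤ._+_ (cong₂ ℤ._-_ (c≗c′ (v i)) (cong (λ b → if b then + deg (v i) else + 0) (S≗S′ (v i))))
                  (cong +_ (countB-cong (allV n d) (λ u → cong (_∧ adj u (v i)) (S≗S′ u))))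
    toppleSet-cong S S′ c c′ S≗S′ c≗c′ (w j) =
      cong₂ ℤ._+_ (cong₂ ℤ._-_ (c≗c′ (w j)) (cong (λ b → if b then + deg (w j) else + 0) (S≗S′ (w j))))
                  (cong +_ (countB-cong (allV n d) (λ u → cong (_∧ adj u (w j)) (S≗S′ u))))

    private
      received-∨ : (S T : Vtx n d → Bool) (z : Vtx n d) → (∀ u → S u ≡ true → T u ≡ false) →
        countB (λ u → (S u ∨ T u) ∧ adj u z) (allV n d)
        ≡ countB (λ u → S u ∧ adj u z) (allV n d) + countB (λ u → T u ∧ adj u z) (allV n d)
      received-∨ S T z disjoint = trans (countB-cong (allV n d) (λ u → ∧-distribʳ-∨ (adj u z) (S u) (T u)))
        (countB-∨ (λ u → S u ∧ adj u z) (λ u → T u ∧ adj u z) (allV n d) disjoint′)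
        where
        disjoint′ : ∀ u → (S u ∧ adj u z) ≡ true → (T u ∧ adj u z) ≡ false
        disjoint′ u Su∧adj with S u in Su
        ... | true rewrite disjoint u Su = refl

      open +-*-Solver

      lost-∨ : ∀ (c D : ℤ) (kS kT : ℕ) (s t : Bool) → (s ≡ true → t ≡ false) →
        ((c ℤ.- (if t then D else + 0)) ℤ.+ + kT) ℤ.- (if s then D else + 0) ℤ.+ + kS
        ≡ (c ℤ.- (if s ∨ t then D else + 0)) ℤ.+ + (kS + kT)
      lost-∨ c D kS kT true  true  s⇒¬t with s⇒¬t refl
      ... | ()
      lost-∨ c D kS kT true  false _ = solve 4 (λ c D x y → ((c :- con (+ 0)) :+ y) :- D :+ x := (c :- D) :+ (x :+ y)) refl c D (+ kS) (+ kT)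
      lost-∨ c D kS kT false t     _ = solve 4 (λ c D′ x y → ((c :- D′) :+ y) :- con (+ 0) :+ x := (c :- D′) :+ (x :+ y)) refl
                                         c (if t then D else + 0) (+ kS) (+ kT)

    toppleSet-∨ : (S T : Vtx n d → Bool) (c : Config n d) → (∀ u → S u ≡ true → T u ≡ false) →
      ∀ z → toppleSet S (toppleSet T c) z ≡ toppleSet (λ u → S u ∨ T u) c z
    toppleSet-∨ S T c disjoint sink  = refl
    toppleSet-∨ S T c disjoint (v i) = trans (lost-∨ (c (v i)) (+ deg (v i)) _ _ (S (v i)) (T (v i)) (disjoint (v i)))
      (cong (λ k → (c (v i) ℤ.- (if S (v i) ∨ T (v i) then + deg (v i) else + 0)) ℤ.+ + k) (sym (received-∨ S T (v i) disjoint)))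
    toppleSet-∨ S T c disjoint (w j) = trans (lost-∨ (c (w j)) (+ deg (w j)) _ _ (S (w j)) (T (w j)) (disjoint (w j)))
      (cong (λ k → (c (w j) ℤ.- (if S (w j) ∨ T (w j) then + deg (w j) else + 0)) ℤ.+ + k) (sym (received-∨ S T (w j) disjoint)))

  private
    ∧-monoˡ : ∀ {a a′} b → (a ≡ true → a′ ≡ true) → (a ∧ b) ≡ true → (a′ ∧ b) ≡ true
    ∧-monoˡ {true} b a⇒a′ a∧b rewrite a⇒a′ refl = a∧b

    more-received : ∀ {D} {c : ℤ} {k k′} → k ≤ k′ → (+ D ℤ.≤ᵇ (c ℤ.+ + k)) ≡ true → (+ D ℤ.≤ᵇ (c ℤ.+ + k′)) ≡ true
    more-received {D} {c} {k} {k′} k≤k′ full =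
      T⇒≡true (ℤ.≤⇒≤ᵇ {+ D} {c ℤ.+ + k′}
        (ℤ.≤-trans (ℤ.≤ᵇ⇒≤ {+ D} {c ℤ.+ + k} (≡true⇒T full)) (ℤ.+-monoʳ-≤ c (ℤ.+≤+ k≤k′))))

  module _ {n d : ℕ} where

    single : Vtx n d → Vtx n d → Bool
    single sink  sink  = true
    single (v i) (v j) = does (i Fin.≟ j)
    single (w i) (w j) = does (i Fin.≟ j)
    single _     _     = false

    single-true : ∀ u z → single u z ≡ true → z ≡ u
    single-true sink  sink  _ = refl
    single-true (v i) (v j) eq with i Fin.≟ j
    ... | yes refl = refl
    single-true (w i) (w j) eq with i Fin.≟ j
    ... | yes refl = refl

    single-false : ∀ u z → z ≢ u → single u z ≡ false
    single-false u z z≢u with single u z in eq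
    ... | true  = contradiction (single-true u z eq) z≢u
    ... | false = refl

    topple≡toppleSet : ∀ (u : Vtx n d) (c : Config n d) z → topple u c z ≡ toppleSet (single u) c z
    topple≡toppleSet sink  c = toppleSet-cong _ (single sink)  c c (λ { sink → refl ; (v _) → refl ; (w _) → refl }) (λ _ → refl)
    topple≡toppleSet (v i) c = toppleSet-cong _ (single (v i)) c c (λ { sink → refl ; (v _) → refl ; (w _) → refl }) (λ _ → refl)
    topple≡toppleSet (w j) c = toppleSet-cong _ (single (w j)) c c (λ { sink → refl ; (v _) → refl ; (w _) → refl }) (λ _ → refl)

    unstable-mono : ∀ (S S′ : Vtx n d → Bool) (c : Config n d) u → (∀ z → S z ≡ true → S′ z ≡ true) → S′ u ≡ false →
      unstableB (toppleSet S c) u ≡ true → unstableB (toppleSet S′ c) u ≡ true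
    unstable-mono S S′ c sink  S⊆S′ u∉S′ unstable = unstable
    unstable-mono S S′ c (v i) S⊆S′ u∉S′ unstable with S (v i) in u∈S
    ... | true  = contradiction (trans (sym (S⊆S′ (v i) u∈S)) u∉S′) (λ ())
    ... | false rewrite u∉S′ = more-received {c = c (v i) ℤ.- + 0} (countB-mono (allV n d) (λ z → ∧-monoˡ (adj z (v i)) (S⊆S′ z))) unstable
    unstable-mono S S′ c (w j) S⊆S′ u∉S′ unstable with S (w j) in u∈S
    ... | true  = contradiction (trans (sym (S⊆S′ (w j) u∈S)) u∉S′) (λ ())
    ... | false rewrite u∉S′ = more-received {c = c (w j) ℤ.- + 0} (countB-mono (allV n d) (λ z → ∧-monoˡ (adj z (w j)) (S⊆S′ z))) unstable

    Unstable⇒unstableB : ∀ (c : Config n d) u → Unstable c u → unstableB c u ≡ true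
    Unstable⇒unstableB c (v i) (_ , full) = T⇒≡true (ℤ.≤⇒≤ᵇ full)
    Unstable⇒unstableB c (w j) (_ , full) = T⇒≡true (ℤ.≤⇒≤ᵇ full)

    unstableB⇒Unstable : ∀ (c : Config n d) u → NonSink u → unstableB c u ≡ true → Unstable c u
    unstableB⇒Unstable c (v i) non-sink full = non-sink , ℤ.≤ᵇ⇒≤ (≡true⇒T full)
    unstableB⇒Unstable c (w j) non-sink full = non-sink , ℤ.≤ᵇ⇒≤ (≡true⇒T full)

    ∈-allV : ∀ z → z ∈ allV n d
    ∈-allV sink  = here refl
    ∈-allV (v i) = there (∈-++⁺ˡ (∈-map⁺ v (∈-allFin i)))
    ∈-allV (w j) = there (∈-++⁺ʳ (map v (allFin n)) (∈-map⁺ w (∈-allFin j)))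

    allV-unique : Unique (allV n d)
    allV-unique = ListAll.tabulate sink∉ ∷ Unique.++⁺ (Unique.map⁺ v-injective (Unique.allFin⁺ n)) (Unique.map⁺ w-injective (Unique.allFin⁺ d)) v≠w
      where
      v-injective : ∀ {i j : Fin n} → v {n} {d} i ≡ v j → i ≡ j
      v-injective refl = refl
      w-injective : ∀ {i j : Fin d} → w {n} {d} i ≡ w j → i ≡ j
      w-injective refl = refl
      sink∉ : ∀ {z} → z ∈ map v (allFin n) ++ map w (allFin d) → sink ≢ z
      sink∉ z∈ refl with ∈-++⁻ (map v (allFin n)) z∈
      ... | inj₁ z∈v with ∈-map⁻ v z∈v
      ...   | _ , _ , ()
      sink∉ z∈ refl | inj₂ z∈w with ∈-map⁻ w z∈w
      ... | _ , _ , ()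
      v≠w : ∀ {z} → ¬ (z ∈ map v (allFin n) × z ∈ map w (allFin d))
      v≠w (z∈v , z∈w) with ∈-map⁻ v z∈v | ∈-map⁻ w z∈w
      ... | _ , _ , refl | _ , _ , ()

  private
    bool-ext : ∀ {a b : Bool} → (a ≡ true → b ≡ true) → (b ≡ true → a ≡ true) → a ≡ b
    bool-ext {true}  {true}  _    _    = refl
    bool-ext {true}  {false} a⇒b _    = sym (a⇒b refl)
    bool-ext {false} {true}  _    b⇒a = b⇒a refl
    bool-ext {false} {false} _    _    = refl

    <ᵇ⇒< : ∀ {a b} → (a <ᵇ b) ≡ true → a < b
    <ᵇ⇒< {a} {b} a<ᵇb = ℕ.<ᵇ⇒< a b (≡true⇒T a<ᵇb)

    <ᵇ-false⇒≥ : ∀ {a b} → (a <ᵇ b) ≡ false → b ≤ a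
    <ᵇ-false⇒≥ {a} {b} a≮ᵇb with a ℕ.<? b
    ... | yes a<b = contradiction (trans (sym a≮ᵇb) (T⇒≡true (ℕ.<⇒<ᵇ a<b))) (λ ())
    ... | no a≮b  = ℕ.≮⇒≥ a≮b

    ≥⇒<ᵇ-false : ∀ {a b} → b ≤ a → (a <ᵇ b) ≡ false
    ≥⇒<ᵇ-false {a} {b} b≤a with a <ᵇ b in a<ᵇb
    ... | true  = contradiction (<ᵇ⇒< a<ᵇb) (ℕ.≤⇒≯ b≤a)
    ... | false = refl

    n<ᵇn : ∀ a → (a <ᵇ a) ≡ false
    n<ᵇn a = ≥⇒<ᵇ-false {a} ℕ.≤-refl

    <ᵇ-suc : ∀ a b → ((b ≡ᵇ a) ∨ (a <ᵇ b)) ≡ (a <ᵇ suc b)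
    <ᵇ-suc zero    zero    = refl
    <ᵇ-suc zero    (suc b) = refl
    <ᵇ-suc (suc a) zero    = refl
    <ᵇ-suc (suc a) (suc b) = <ᵇ-suc a b

    <ᵇ-widen : ∀ k {b b′} → b ≤ b′ → ((not (k <ᵇ b) ∧ (k <ᵇ b′)) ∨ (k <ᵇ b)) ≡ (k <ᵇ b′)
    <ᵇ-widen k {b} {b′} b≤b′ with k <ᵇ b in k<ᵇb
    ... | true  = sym (T⇒≡true (ℕ.<⇒<ᵇ (ℕ.<-≤-trans (<ᵇ⇒< k<ᵇb) b≤b′)))
    ... | false with k <ᵇ b′
    ...   | true  = refl
    ...   | false = refl

    not-<ᵇ : ∀ k b {c} → (not (k <ᵇ b) ∧ c) ≡ true → (k <ᵇ b) ≡ false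
    not-<ᵇ k b _ with k <ᵇ b
    ... | false = refl

    ≤ᵇ-+-shift : ∀ m a k → (m ≤ᵇ (a + 0 + k)) ≡ ((m ∸ k) ≤ᵇ a)
    ≤ᵇ-+-shift m a k = bool-ext
      (λ m≤ → T⇒≡true (ℕ.≤⇒≤ᵇ (ℕ.m≤n+o⇒m∸n≤o m k
                                  (ℕ.≤-trans (ℕ.≤ᵇ⇒≤ m _ (≡true⇒T m≤)) (ℕ.≤-reflexive a+0+k≡k+a)))))
      (λ m∸k≤ → T⇒≡true (ℕ.≤⇒≤ᵇ (ℕ.≤-trans (ℕ.m≤n+m∸n m k)
                                   (ℕ.≤-trans (ℕ.+-monoʳ-≤ k (ℕ.≤ᵇ⇒≤ _ a (≡true⇒T m∸k≤))) (ℕ.≤-reflexive (sym a+0+k≡k+a))))))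
      where
      a+0+k≡k+a : a + 0 + k ≡ k + a
      a+0+k≡k+a = trans (cong (_+ k) (ℕ.+-identityʳ a)) (ℕ.+-comm a k)

    below-capacity : ∀ a D k → a + k < D + D → (+ D ℤ.≤ᵇ ((+ a ℤ.- + D) ℤ.+ + k)) ≡ false
    below-capacity a D k a+k<2D with + D ℤ.≤ᵇ ((+ a ℤ.- + D) ℤ.+ + k) in unstable
    ... | false = refl
    ... | true  = contradiction (ℤ.drop‿+≤+ (ℤ.≤-trans (ℤ.+-monoˡ-≤ (+ D) (ℤ.≤ᵇ⇒≤ {+ D} {(+ a ℤ.- + D) ℤ.+ + k} (≡true⇒T unstable)))
                                                      (ℤ.≤-reflexive regroup)))
                               (ℕ.<⇒≱ a+k<2D)
      where
      open +-*-Solver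
      regroup : ((+ a ℤ.- + D) ℤ.+ + k) ℤ.+ + D ≡ + (a + k)
      regroup = solve 3 (λ a D k → ((a :- D) :+ k) :+ D := a :+ k) refl (+ a) (+ D) (+ k)

  module Dynamics (n d : ℕ) (x : Vec ℕ n) (y : Vec ℕ d) (x↓ : DecreasingIn x 0 (n + d)) (y↓ : DecreasingIn y 0 (suc n)) where

    open AbstractITC.Run n d x y
    open import Data.List.Relation.Binary.Permutation.Setoid.Properties (setoid (Vtx n d)) using (Unique-resp-↭)

    config : Config n d
    config = toConfig (x , y)

    toppled : ℕ → ℕ → Vtx n d → Bool
    toppled α β sink  = true
    toppled α β (v i) = toℕ i <ᵇ α
    toppled α β (w j) = toℕ j <ᵇ β

    countB-allV : ∀ (p : Vtx n d → Bool) (P Q : ℕ → Bool) → (∀ k → p (v k) ≡ P (toℕ k)) → (∀ k → p (w k) ≡ Q (toℕ k)) →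
      countB p (allV n d) ≡ (if p sink then suc (countBelow P n + countBelow Q d) else countBelow P n + countBelow Q d)
    countB-allV p P Q p≗P p≗Q = cong (λ k → if p sink then suc k else k) (trans (countB-++ p (map v (allFin n)) (map w (allFin d)))
      (cong₂ _+_ (trans (countB-map p v (allFin n)) (countB-tabulate n (λ k → k) (λ k → p (v k)) P p≗P))
                 (trans (countB-map p w (allFin d)) (countB-tabulate d (λ k → k) (λ k → p (w k)) Q p≗Q))))

    received-v : ∀ α β (i : Fin n) → β ≤ d →
      countB (λ u → toppled α β u ∧ adj u (v i)) (allV n d) ≡ suc (countBelow (λ j → (j <ᵇ α) ∧ not (j ≡ᵇ toℕ i)) n + β)
    received-v α β i β≤d =
      trans (countB-allV (λ u → toppled α β u ∧ adj u (v i)) (λ j → (j <ᵇ α) ∧ not (j ≡ᵇ toℕ i)) (λ j → j <ᵇ β)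
                         (λ k → cong (λ b → (toℕ k <ᵇ α) ∧ not b) (does-Fin-≟ k i)) (λ k → ∧-identityʳ (toℕ k <ᵇ β)))
            (cong (λ b → suc (countBelow (λ j → (j <ᵇ α) ∧ not (j ≡ᵇ toℕ i)) n + b)) (countBelow-< d β≤d))

    received-w : ∀ α β (j : Fin d) → α ≤ n → countB (λ u → toppled α β u ∧ adj u (w j)) (allV n d) ≡ suc (α + 0)
    received-w α β j α≤n =
      trans (countB-allV (λ u → toppled α β u ∧ adj u (w j)) (λ k → k <ᵇ α) (λ _ → false)
                         (λ k → ∧-identityʳ (toℕ k <ᵇ α)) (λ k → ∧-zeroʳ (toℕ k <ᵇ β)))
            (cong₂ (λ a b → suc (a + b)) (countBelow-< n α≤n) (countBelow-false d))

    x<n+d : ∀ i → lookup x i < n + d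
    x<n+d = DecreasingIn-lookup x x↓

    y<1+n : ∀ j → lookup y j < suc n
    y<1+n = DecreasingIn-lookup y y↓

    unstable-v : ∀ α β → α ≤ n → β ≤ d → ∀ i →
      unstableB (toppleSet (toppled α β) config) (v i) ≡ not (toℕ i <ᵇ α) ∧ (toℕ i <ᵇ reachedV α β)
    unstable-v α β α≤n β≤d i rewrite received-v α β i β≤d with toℕ i <ᵇ α in i<ᵇα
    ... | true  = below-capacity (lookup x i) (n + d) _
                    (ℕ.+-mono-<-≤ (x<n+d i) (ℕ.≤-trans (ℕ.≤-reflexive (cong (_+ β) (countBelow-<-≢-in n (<ᵇ⇒< i<ᵇα) α≤n)))
                                                       (ℕ.+-mono-≤ α≤n β≤d)))
    ... | false = trans (cong (λ k → (n + d) ≤ᵇ (lookup x i + 0 + suc (k + β))) (countBelow-<-≢-out n (<ᵇ-false⇒≥ i<ᵇα) α≤n))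
                        (trans (≤ᵇ-+-shift (n + d) (lookup x i) (suc (α + β))) (lookup-countAtLeast x _ x↓ i))

    unstable-w : ∀ α β → α ≤ n → β ≤ d → ∀ j →
      unstableB (toppleSet (toppled α β) config) (w j) ≡ not (toℕ j <ᵇ β) ∧ (toℕ j <ᵇ reachedW α)
    unstable-w α β α≤n β≤d j rewrite received-w α β j α≤n with toℕ j <ᵇ β
    ... | true  = below-capacity (lookup y j) (n + 1) (suc (α + 0))
                    (ℕ.+-mono-<-≤ (ℕ.≤-trans (y<1+n j) (ℕ.≤-reflexive (ℕ.+-comm 1 n)))
                                  (ℕ.≤-trans (s≤s (ℕ.≤-trans (ℕ.≤-reflexive (ℕ.+-identityʳ α)) α≤n)) (ℕ.≤-reflexive (ℕ.+-comm 1 n))))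
    ... | false = trans (≤ᵇ-+-shift (n + 1) (lookup y j) (suc (α + 0)))
                        (trans (cong (_≤ᵇ lookup y j) (trans (cong (_∸ suc (α + 0)) (ℕ.+-comm n 1)) (cong (n ∸_) (ℕ.+-identityʳ α))))
                               (lookup-countAtLeast y _ y↓ j))

    unstableB-cong : ∀ (c c′ : Config n d) → (∀ z → c z ≡ c′ z) → ∀ u → unstableB c u ≡ unstableB c′ u
    unstableB-cong c c′ c≗c′ sink  = refl
    unstableB-cong c c′ c≗c′ (v i) = cong (+ deg (v i) ℤ.≤ᵇ_) (c≗c′ (v i))
    unstableB-cong c c′ c≗c′ (w j) = cong (+ deg (w j) ℤ.≤ᵇ_) (c≗c′ (w j))

    countB-unstable : ∀ α β → BelowReach α β →
      countB (unstableB (toppleSet (toppled α β) config)) (allV n d) ≡ (reachedV α β ∸ α) + (reachedW α ∸ β)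
    countB-unstable α β (β≤w , α≤v) =
      trans (countB-allV (unstableB (toppleSet (toppled α β) config))
                         (λ j → not (j <ᵇ α) ∧ (j <ᵇ reachedV α β)) (λ j → not (j <ᵇ β) ∧ (j <ᵇ reachedW α))
                         (unstable-v α β α≤n β≤d) (unstable-w α β α≤n β≤d))
            (cong₂ _+_ (countBelow-range n α≤v (reachedV≤n α β)) (countBelow-range d β≤w (reachedW≤d α)))
      where
      α≤n = BelowReach⇒α≤n (β≤w , α≤v)
      β≤d = BelowReach⇒β≤d (β≤w , α≤v)

    w-round : ∀ α β (c : Config n d) → (∀ z → c z ≡ toppleSet (toppled α β) config z) → BelowReach α β →
      countB (λ u → isW u ∧ unstableB c u) (allV n d) ≡ reachedW α ∸ β ×
      (∀ z → toppleSet (λ u → isW u ∧ unstableB c u) c z ≡ toppleSet (toppled α (reachedW α)) config z)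
    w-round α β c c≈ below@(β≤w , _) = count≡ , after
      where
      Q : Vtx n d → Bool
      Q u = isW u ∧ unstableB c u
      Q-w : ∀ k → Q (w k) ≡ not (toℕ k <ᵇ β) ∧ (toℕ k <ᵇ reachedW α)
      Q-w k = trans (unstableB-cong c _ c≈ (w k)) (unstable-w α β (BelowReach⇒α≤n below) (BelowReach⇒β≤d below) k)
      count≡ = trans (countB-allV Q (λ _ → false) (λ j → not (j <ᵇ β) ∧ (j <ᵇ reachedW α)) (λ _ → refl) Q-w)
                     (cong₂ _+_ (countBelow-false n) (countBelow-range d β≤w (reachedW≤d α)))
      extends : ∀ u → (Q u ∨ toppled α β u) ≡ toppled α (reachedW α) u
      extends sink  = refl
      extends (v k) = refl
      extends (w k) = trans (cong (_∨ (toℕ k <ᵇ β)) (Q-w k)) (<ᵇ-widen (toℕ k) β≤w)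
      fresh : ∀ u → Q u ≡ true → toppled α β u ≡ false
      fresh (w k) Qu = not-<ᵇ (toℕ k) β (trans (sym (Q-w k)) Qu)
      after : ∀ z → toppleSet Q c z ≡ toppleSet (toppled α (reachedW α)) config z
      after z = trans (toppleSet-cong Q Q c _ (λ _ → refl) c≈ z)
                      (trans (toppleSet-∨ Q (toppled α β) config fresh z) (toppleSet-cong _ _ config config extends (λ _ → refl) z))

    v-round : ∀ α β (c : Config n d) → (∀ z → c z ≡ toppleSet (toppled α β) config z) → α ≤ n → β ≤ d → α ≤ reachedV α β →
      countB (λ u → isV u ∧ unstableB c u) (allV n d) ≡ reachedV α β ∸ α ×
      (∀ z → toppleSet (λ u → isV u ∧ unstableB c u) c z ≡ toppleSet (toppled (reachedV α β) β) config z)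
    v-round α β c c≈ α≤n β≤d α≤v = count≡ , after
      where
      P : Vtx n d → Bool
      P u = isV u ∧ unstableB c u
      P-v : ∀ k → P (v k) ≡ not (toℕ k <ᵇ α) ∧ (toℕ k <ᵇ reachedV α β)
      P-v k = trans (unstableB-cong c _ c≈ (v k)) (unstable-v α β α≤n β≤d k)
      count≡ = trans (countB-allV P (λ j → not (j <ᵇ α) ∧ (j <ᵇ reachedV α β)) (λ _ → false) P-v (λ _ → refl))
                     (trans (cong₂ _+_ (countBelow-range n α≤v (reachedV≤n α β)) (countBelow-false d)) (ℕ.+-identityʳ _))
      extends : ∀ u → (P u ∨ toppled α β u) ≡ toppled (reachedV α β) β u
      extends sink  = refl
      extends (v k) = trans (cong (_∨ (toℕ k <ᵇ α)) (P-v k)) (<ᵇ-widen (toℕ k) α≤v)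
      extends (w k) = refl
      fresh : ∀ u → P u ≡ true → toppled α β u ≡ false
      fresh (v k) Pu = not-<ᵇ (toℕ k) α (trans (sym (P-v k)) Pu)
      after : ∀ z → toppleSet P c z ≡ toppleSet (toppled (reachedV α β) β) config z
      after z = trans (toppleSet-cong P P c _ (λ _ → refl) c≈ z)
                      (trans (toppleSet-∨ P (toppled α β) config fresh z) (toppleSet-cong _ _ config config extends (λ _ → refl) z))

    itcRun≡run : ∀ f α β (c : Config n d) → (∀ z → c z ≡ toppleSet (toppled α β) config z) → BelowReach α β → itcRun f c ≡ run f α β
    itcRun≡run zero    α β c c≈ below = refl
    itcRun≡run (suc f) α β c c≈ below =
      cong₂ _∷_ (cong₂ _,_ (proj₁ W) (proj₁ V))
                (cong₂ (λ b l → if b then [] else l) settled≡ (itcRun≡run f _ _ _ (proj₂ V) (BelowReach-step below)))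
      where
      W = w-round α β c c≈ below
      V = v-round α (reachedW α) _ (proj₂ W) (BelowReach⇒α≤n below) (reachedW≤d α) (proj₁ (step-≥ below))
      settled≡ = cong (_≡ᵇ 0) (trans (countB-cong (allV n d) (unstableB-cong _ _ (proj₂ V)))
                                     (countB-unstable _ _ (BelowReach-step below)))

    topple-sink : ∀ z → topple sink config z ≡ toppleSet (toppled 0 0) config z
    topple-sink z = trans (topple≡toppleSet sink config z)
      (toppleSet-cong (single sink) (toppled 0 0) config config (λ { sink → refl ; (v _) → refl ; (w _) → refl }) (λ _ → refl) z)

    itcSeq≡run : itcSeq (x , y) ≡ run (suc (n + d)) 0 0
    itcSeq≡run = itcRun≡run (suc (n + d)) 0 0 (topple sink config) topple-sink BelowReach-0

    α* β* : ℕ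
    α* = proj₁ (runEnd (suc (n + d)) 0 0)
    β* = proj₂ (runEnd (suc (n + d)) 0 0)

    below* : BelowReach α* β*
    below* = runEnd-BelowReach (suc (n + d)) 0 0 BelowReach-0

    settled* : settled α* β* ≡ true
    settled* = runEnd-settled (n + d) 0 0 BelowReach-0 (ℕ.m≤m+n n d)

    untoppled-stable : ∀ u → toppled α* β* u ≡ false → unstableB (toppleSet (toppled α* β*) config) u ≡ false
    untoppled-stable (v i) i≥α* rewrite unstable-v α* β* (BelowReach⇒α≤n below*) (BelowReach⇒β≤d below*) i | i≥α* =
      ≥⇒<ᵇ-false (ℕ.≤-trans (proj₁ (settled⇒ α* β* settled*)) (<ᵇ-false⇒≥ i≥α*))
    untoppled-stable (w j) j≥β* rewrite unstable-w α* β* (BelowReach⇒α≤n below*) (BelowReach⇒β≤d below*) j | j≥β* =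
      ≥⇒<ᵇ-false (ℕ.≤-trans (proj₂ (settled⇒ α* β* settled*)) (<ᵇ-false⇒≥ j≥β*))

    -- Toppling more vertices only adds grains, and every vertex outside the final state of the run is
    -- stable there, so no legal toppling sequence can reach it.
    legal-toppling-stays-below : ∀ (us : List (Vtx n d)) (S : Vtx n d → Bool) (c : Config n d) → (∀ z → c z ≡ toppleSet S config z) →
      (∀ z → S z ≡ true → toppled α* β* z ≡ true) → Unique us → (∀ u → u ∈ us → S u ≡ false) → ValidSeq c us →
      ∀ u → u ∈ us → toppled α* β* u ≡ true
    legal-toppling-stays-below (u ∷ us) S c c≈ S⊆* (u∉us ∷ !us) fresh (u-unstable , rest) = within
      where
      u∈* : toppled α* β* u ≡ true
      u∈* with toppled α* β* u in u∉*
      ... | true  = refl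
      ... | false = contradiction (trans (sym (unstable-mono S _ config u S⊆* u∉*
                                                (trans (sym (unstableB-cong c _ c≈ u)) (Unstable⇒unstableB c u u-unstable))))
                                         (untoppled-stable u u∉*)) (λ ())
      S′ : Vtx n d → Bool
      S′ z = single u z ∨ S z
      c′≈ : ∀ z → topple u c z ≡ toppleSet S′ config z
      c′≈ z = trans (topple≡toppleSet u c z) (trans (toppleSet-cong (single u) (single u) c (toppleSet S config) (λ _ → refl) c≈ z)
                    (toppleSet-∨ (single u) S config
                                 (λ z single≡ → subst (λ z → S z ≡ false) (sym (single-true u z single≡)) (fresh u (here refl))) z))
      S′⊆* : ∀ z → S′ z ≡ true → toppled α* β* z ≡ true
      S′⊆* z S′z with single u z in single≡
      ... | true  rewrite single-true u z single≡ = u∈*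
      ... | false = S⊆* z S′z
      fresh′ : ∀ z → z ∈ us → S′ z ≡ false
      fresh′ z z∈us rewrite single-false u z (λ z≡u → ListAll.lookup u∉us z∈us (sym z≡u)) = fresh z (there z∈us)
      within : ∀ z → z ∈ u ∷ us → toppled α* β* z ≡ true
      within z (here refl)  = u∈*
      within z (there z∈us) = legal-toppling-stays-below us S′ (topple u c) c′≈ S′⊆* !us fresh′ rest z z∈us

    private
      all-below⇒≡ : ∀ m a → a ≤ m → (∀ (i : Fin m) → toℕ i < a) → a ≡ m
      all-below⇒≡ zero    a a≤m _       = ℕ.n≤0⇒n≡0 a≤m
      all-below⇒≡ (suc m) a a≤m all-below = ℕ.≤-antisym a≤m (subst (_< a) (Fin.toℕ-fromℕ m) (all-below (Fin.fromℕ m)))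

    recurrent⇒runEnd≡ : Recurrent config → runEnd (suc (n + d)) 0 0 ≡ (n , d)
    recurrent⇒runEnd≡ (_ , rest , sink∷rest↭allV , legal) =
      cong₂ _,_ (all-below⇒≡ n α* (BelowReach⇒α≤n below*) (λ i → <ᵇ⇒< (toppled* (v i) refl)))
                (all-below⇒≡ d β* (BelowReach⇒β≤d below*) (λ j → <ᵇ⇒< (toppled* (w j) refl)))
      where
      !sink∷rest : Unique (sink ∷ rest)
      !sink∷rest = Unique-resp-↭ (↭⇒↭ₛ (↭-sym sink∷rest↭allV)) allV-unique
      ∈-rest : ∀ z → NonSink z → z ∈ rest
      ∈-rest z non-sink with ∈-resp-↭ (↭-sym sink∷rest↭allV) (∈-allV z)
      ∈-rest sink () | here refl
      ... | there z∈rest = z∈rest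
      toppled* : ∀ z → NonSink z → toppled α* β* z ≡ true
      toppled* z non-sink with !sink∷rest
      ... | sink∉rest ∷ !rest = legal-toppling-stays-below rest (single sink) (topple sink config) (topple≡toppleSet sink config)
        (λ z single≡ → subst (λ z → toppled α* β* z ≡ true) (sym (single-true sink z single≡)) refl) !rest
        (λ z z∈rest → single-false sink z (λ z≡sink → ListAll.lookup sink∉rest z∈rest (sym z≡sink))) legal z (∈-rest z non-sink)

    toppleOrder : ℕ → ℕ → ℕ → List (Vtx n d)
    toppleOrder zero    α β = []
    toppleOrder (suc k) α β with β ℕ.<? reachedW α
    ... | yes β<w = w (Fin.fromℕ< (ℕ.<-≤-trans β<w (reachedW≤d α))) ∷ toppleOrder k α (suc β)
    ... | no _ with α ℕ.<? reachedV α β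
    ...   | yes α<v = v (Fin.fromℕ< (ℕ.<-≤-trans α<v (reachedV≤n α β))) ∷ toppleOrder k (suc α) β
    ...   | no _    = []

    Untoppled : ℕ → ℕ → Vtx n d → Set
    Untoppled α β sink  = ⊥
    Untoppled α β (v i) = α ≤ toℕ i
    Untoppled α β (w j) = β ≤ toℕ j

    toppleOrder-untoppled : ∀ k α β u → u ∈ toppleOrder k α β → Untoppled α β u
    toppleOrder-untoppled (suc k) α β u u∈ with β ℕ.<? reachedW α
    toppleOrder-untoppled (suc k) α β u     (here refl)  | yes _ = ℕ.≤-reflexive (sym (Fin.toℕ-fromℕ< _))
    toppleOrder-untoppled (suc k) α β sink  (there u∈)   | yes _ = toppleOrder-untoppled k α (suc β) sink u∈
    toppleOrder-untoppled (suc k) α β (v i) (there u∈)   | yes _ = toppleOrder-untoppled k α (suc β) (v i) u∈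
    toppleOrder-untoppled (suc k) α β (w j) (there u∈)   | yes _ = ℕ.<⇒≤ (toppleOrder-untoppled k α (suc β) (w j) u∈)
    ... | no _ with α ℕ.<? reachedV α β
    toppleOrder-untoppled (suc k) α β u     (here refl)  | no _ | yes _ = ℕ.≤-reflexive (sym (Fin.toℕ-fromℕ< _))
    toppleOrder-untoppled (suc k) α β sink  (there u∈)   | no _ | yes _ = toppleOrder-untoppled k (suc α) β sink u∈
    toppleOrder-untoppled (suc k) α β (v i) (there u∈)   | no _ | yes _ = ℕ.<⇒≤ (toppleOrder-untoppled k (suc α) β (v i) u∈)
    toppleOrder-untoppled (suc k) α β (w j) (there u∈)   | no _ | yes _ = toppleOrder-untoppled k (suc α) β (w j) u∈

    toppleOrder-unique : ∀ k α β → Unique (toppleOrder k α β)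
    toppleOrder-unique zero    α β = []
    toppleOrder-unique (suc k) α β with β ℕ.<? reachedW α
    ... | yes _ = ListAll.tabulate (λ u∈ eq → not-again _ u∈ eq (Fin.toℕ-fromℕ< _)) ∷ toppleOrder-unique k α (suc β)
      where
      not-again : ∀ {j} z → z ∈ toppleOrder k α (suc β) → w j ≡ z → toℕ j ≢ β
      not-again z z∈ refl j≡β = ℕ.<-irrefl (sym j≡β) (toppleOrder-untoppled k α (suc β) z z∈)
    ... | no _ with α ℕ.<? reachedV α β
    ...   | yes _ = ListAll.tabulate (λ u∈ eq → not-again _ u∈ eq (Fin.toℕ-fromℕ< _)) ∷ toppleOrder-unique k (suc α) β
      where
      not-again : ∀ {i} z → z ∈ toppleOrder k (suc α) β → v i ≡ z → toℕ i ≢ α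
      not-again z z∈ refl i≡α = ℕ.<-irrefl (sym i≡α) (toppleOrder-untoppled k (suc α) β z z∈)
    ...   | no _  = []

    topple-next-w : ∀ α β (c : Config n d) → (∀ z → c z ≡ toppleSet (toppled α β) config z) → α ≤ n → β ≤ d →
      (j : Fin d) → toℕ j ≡ β → β < reachedW α →
      Unstable c (w j) × (∀ z → topple (w j) c z ≡ toppleSet (toppled α (suc β)) config z)
    topple-next-w α .(toℕ j) c c≈ α≤n β≤d j refl β<w = unstableB⇒Unstable c (w j) refl unstable , after
      where
      unstable : unstableB c (w j) ≡ true
      unstable = trans (unstableB-cong c _ c≈ (w j))
        (trans (unstable-w α (toℕ j) α≤n β≤d j) (cong₂ (λ a b → not a ∧ b) (n<ᵇn (toℕ j)) (T⇒≡true (ℕ.<⇒<ᵇ β<w))))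
      fresh : ∀ z → single (w j) z ≡ true → toppled α (toℕ j) z ≡ false
      fresh z single≡ rewrite single-true (w j) z single≡ = n<ᵇn (toℕ j)
      extends : ∀ z → (single (w j) z ∨ toppled α (toℕ j) z) ≡ toppled α (suc (toℕ j)) z
      extends sink  = refl
      extends (v k) = refl
      extends (w k) = trans (cong (_∨ (toℕ k <ᵇ toℕ j)) (does-Fin-≟ j k)) (<ᵇ-suc (toℕ k) (toℕ j))
      after : ∀ z → topple (w j) c z ≡ toppleSet (toppled α (suc (toℕ j))) config z
      after z = trans (topple≡toppleSet (w j) c z) (trans (toppleSet-cong (single (w j)) (single (w j)) c _ (λ _ → refl) c≈ z)
                  (trans (toppleSet-∨ (single (w j)) (toppled α (toℕ j)) config fresh z) (toppleSet-cong _ _ config config extends (λ _ → refl) z)))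

    topple-next-v : ∀ α β (c : Config n d) → (∀ z → c z ≡ toppleSet (toppled α β) config z) → α ≤ n → β ≤ d →
      (i : Fin n) → toℕ i ≡ α → α < reachedV α β →
      Unstable c (v i) × (∀ z → topple (v i) c z ≡ toppleSet (toppled (suc α) β) config z)
    topple-next-v .(toℕ i) β c c≈ α≤n β≤d i refl α<v = unstableB⇒Unstable c (v i) refl unstable , after
      where
      unstable : unstableB c (v i) ≡ true
      unstable = trans (unstableB-cong c _ c≈ (v i))
        (trans (unstable-v (toℕ i) β α≤n β≤d i) (cong₂ (λ a b → not a ∧ b) (n<ᵇn (toℕ i)) (T⇒≡true (ℕ.<⇒<ᵇ α<v))))
      fresh : ∀ z → single (v i) z ≡ true → toppled (toℕ i) β z ≡ false
      fresh z single≡ rewrite single-true (v i) z single≡ = n<ᵇn (toℕ i)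
      extends : ∀ z → (single (v i) z ∨ toppled (toℕ i) β z) ≡ toppled (suc (toℕ i)) β z
      extends sink  = refl
      extends (v k) = trans (cong (_∨ (toℕ k <ᵇ toℕ i)) (does-Fin-≟ i k)) (<ᵇ-suc (toℕ k) (toℕ i))
      extends (w k) = refl
      after : ∀ z → topple (v i) c z ≡ toppleSet (toppled (suc (toℕ i)) β) config z
      after z = trans (topple≡toppleSet (v i) c z) (trans (toppleSet-cong (single (v i)) (single (v i)) c _ (λ _ → refl) c≈ z)
                  (trans (toppleSet-∨ (single (v i)) (toppled (toℕ i) β) config fresh z) (toppleSet-cong _ _ config config extends (λ _ → refl) z)))

    module _ (complete : runEnd (suc (n + d)) 0 0 ≡ (n , d)) where

      stuck⇒full : ∀ α β → reachedV α β ≤ α → reachedW α ≤ β → n ≤ α × d ≤ β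
      stuck⇒full α β v≤α w≤β = subst (λ end → proj₁ end ≤ α × proj₂ end ≤ β) complete (runEnd-≤ (suc (n + d)) v≤α w≤β z≤n z≤n)

      no-room : ∀ k α β → α + β + suc k ≡ n + d → ¬ (n ≤ α × d ≤ β)
      no-room k α β count (n≤α , d≤β) =
        ℕ.<-irrefl refl (ℕ.<-≤-trans (ℕ.m<m+n (α + β) (s≤s z≤n)) (ℕ.≤-trans (ℕ.≤-reflexive count) (ℕ.+-mono-≤ n≤α d≤β)))

      toppleOrder-legal : ∀ k α β (c : Config n d) → α + β + k ≡ n + d → α ≤ n → β ≤ d →
        (∀ z → c z ≡ toppleSet (toppled α β) config z) → ValidSeq c (toppleOrder k α β)
      toppleOrder-legal zero    α β c _ _ _ _ = tt
      toppleOrder-legal (suc k) α β c count α≤n β≤d c≈ with β ℕ.<? reachedW α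
      ... | yes β<w with topple-next-w α β c c≈ α≤n β≤d _ (Fin.toℕ-fromℕ< _) β<w
      ...   | unstable , c′≈ = unstable , toppleOrder-legal k α (suc β) _ count′ α≤n (ℕ.<-≤-trans β<w (reachedW≤d α)) c′≈
        where
        count′ = trans (cong (_+ k) (ℕ.+-suc α β)) (trans (sym (ℕ.+-suc (α + β) k)) count)
      toppleOrder-legal (suc k) α β c count α≤n β≤d c≈ | no β≮w with α ℕ.<? reachedV α β
      ... | yes α<v with topple-next-v α β c c≈ α≤n β≤d _ (Fin.toℕ-fromℕ< _) α<v
      ...   | unstable , c′≈ =
        unstable , toppleOrder-legal k (suc α) β _ (trans (sym (ℕ.+-suc (α + β) k)) count) (ℕ.<-≤-trans α<v (reachedV≤n α β)) β≤d c′≈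
      toppleOrder-legal (suc k) α β c count α≤n β≤d c≈ | no β≮w | no α≮v =
        contradiction (stuck⇒full α β (ℕ.≮⇒≥ α≮v) (ℕ.≮⇒≥ β≮w)) (no-room k α β count)

      toppleOrder-complete : ∀ k α β → α + β + k ≡ n + d → α ≤ n → β ≤ d → ∀ u → Untoppled α β u → u ∈ toppleOrder k α β
      toppleOrder-complete zero α β count α≤n β≤d (v i) α≤i =
        contradiction (ℕ.<-≤-trans (Fin.toℕ<n i) (ℕ.≤-trans n≤α α≤i)) (ℕ.<-irrefl refl)
        where
        n≤α = ℕ.+-cancelʳ-≤ d n α (ℕ.≤-trans (ℕ.≤-reflexive (trans (sym count) (ℕ.+-identityʳ (α + β)))) (ℕ.+-monoʳ-≤ α β≤d))
      toppleOrder-complete zero α β count α≤n β≤d (w j) β≤j =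
        contradiction (ℕ.<-≤-trans (Fin.toℕ<n j) (ℕ.≤-trans d≤β β≤j)) (ℕ.<-irrefl refl)
        where
        d≤β = ℕ.+-cancelˡ-≤ n d β (ℕ.≤-trans (ℕ.≤-reflexive (trans (sym count) (ℕ.+-identityʳ (α + β)))) (ℕ.+-monoˡ-≤ β α≤n))
      toppleOrder-complete (suc k) α β count α≤n β≤d u untoppled with β ℕ.<? reachedW α
      ... | yes β<w = here-or-later u untoppled
        where
        count′ = trans (cong (_+ k) (ℕ.+-suc α β)) (trans (sym (ℕ.+-suc (α + β) k)) count)
        later = toppleOrder-complete k α (suc β) count′ α≤n (ℕ.<-≤-trans β<w (reachedW≤d α))
        here-or-later : ∀ u → Untoppled α β u → u ∈ w (Fin.fromℕ< (ℕ.<-≤-trans β<w (reachedW≤d α))) ∷ toppleOrder k α (suc β)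
        here-or-later (v i) α≤i = there (later (v i) α≤i)
        here-or-later (w j) β≤j with toℕ j ℕ.≟ β
        ... | yes j≡β = here (cong w (Fin.toℕ-injective (trans j≡β (sym (Fin.toℕ-fromℕ< _)))))
        ... | no j≢β  = there (later (w j) (ℕ.≤∧≢⇒< β≤j (λ β≡j → j≢β (sym β≡j))))
      ... | no β≮w with α ℕ.<? reachedV α β
      ...   | yes α<v = here-or-later u untoppled
        where
        later = toppleOrder-complete k (suc α) β (trans (sym (ℕ.+-suc (α + β) k)) count) (ℕ.<-≤-trans α<v (reachedV≤n α β)) β≤d
        here-or-later : ∀ u → Untoppled α β u → u ∈ v (Fin.fromℕ< (ℕ.<-≤-trans α<v (reachedV≤n α β))) ∷ toppleOrder k (suc α) β
        here-or-later (w j) β≤j = there (later (w j) β≤j)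
        here-or-later (v i) α≤i with toℕ i ℕ.≟ α
        ... | yes i≡α = here (cong v (Fin.toℕ-injective (trans i≡α (sym (Fin.toℕ-fromℕ< _)))))
        ... | no i≢α  = there (later (v i) (ℕ.≤∧≢⇒< α≤i (λ α≡i → i≢α (sym α≡i))))
      ...   | no α≮v = contradiction (stuck⇒full α β (ℕ.≮⇒≥ α≮v) (ℕ.≮⇒≥ β≮w)) (no-room k α β count)

      runEnd≡⇒recurrent : Recurrent config
      runEnd≡⇒recurrent = stable , toppleOrder (n + d) 0 0 , sink∷order↭allV ,
                          toppleOrder-legal (n + d) 0 0 (topple sink config) refl z≤n z≤n topple-sink
        where
        stable : Stable config
        stable (v i) _ = ℤ.+<+ (x<n+d i)
        stable (w j) _ = ℤ.+<+ (ℕ.≤-trans (y<1+n j) (ℕ.≤-reflexive (ℕ.+-comm 1 n)))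
        !sink∷order : Unique (sink ∷ toppleOrder (n + d) 0 0)
        !sink∷order = ListAll.tabulate (λ {z} z∈ sink≡z → subst (Untoppled 0 0) (sym sink≡z) (toppleOrder-untoppled (n + d) 0 0 z z∈))
                      ∷ toppleOrder-unique (n + d) 0 0
        ∈-sink∷order : ∀ z → z ∈ sink ∷ toppleOrder (n + d) 0 0
        ∈-sink∷order sink  = here refl
        ∈-sink∷order (v i) = there (toppleOrder-complete (n + d) 0 0 refl z≤n z≤n (v i) z≤n)
        ∈-sink∷order (w j) = there (toppleOrder-complete (n + d) 0 0 refl z≤n z≤n (w j) z≤n)
        sink∷order↭allV : (sink ∷ toppleOrder (n + d) 0 0) ↭ allV n d
        sink∷order↭allV = unique-↭ !sink∷order allV-unique (λ _ → ∈-allV _) (λ _ → ∈-sink∷order _)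

module Exponents where

  open import Defs using (qmultinom; itcTerm; wsum)
  open Sums
  open QBinomial
  open DecreasingVectors
  open Thresholds
  open import Data.Nat
  open import Data.Nat.Properties
  open import Data.Nat.Combinatorics using (_C_; nC1≡n; nCk+nC[k+1]≡[n+1]C[k+1])
  open import Data.Nat.Solver using (module +-*-Solver)
  open import Data.List using (List; []; _∷_)
  open import Data.Vec using (sum)
  open import Data.Product using (_×_; _,_)
  open import Data.Sum using (_⊎_; inj₁; inj₂)
  open import Data.Unit using (⊤; tt)
  open import Relation.Binary.PropositionalEquality
  open +-*-Solver
  open ≡-Reasoning

  triangle : ℕ → ℕ
  triangle zero    = 0
  triangle (suc m) = m + triangle m

  C2≡triangle : ∀ m → m C 2 ≡ triangle m
  C2≡triangle zero    = refl
  C2≡triangle (suc m) = trans (sym (nCk+nC[k+1]≡[n+1]C[k+1] m 1)) (cong₂ _+_ (nC1≡n m) (C2≡triangle m))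

  triangle-+ : ∀ a b → triangle (a + b) ≡ triangle a + a * b + triangle b
  triangle-+ zero    b = refl
  triangle-+ (suc a) b = begin
    a + b + triangle (a + b)                     ≡⟨ cong (a + b +_) (triangle-+ a b) ⟩
    a + b + (triangle a + a * b + triangle b)    ≡⟨ solve 5 (λ a b ta ab tb → a :+ b :+ (ta :+ ab :+ tb) := a :+ ta :+ (b :+ ab) :+ tb)
                                                       refl a b (triangle a) (a * b) (triangle b) ⟩
    a + triangle a + (b + a * b) + triangle b    ∎

  square≡triangle : ∀ m → m * m ≡ triangle m + triangle m + m
  square≡triangle zero    = refl
  square≡triangle (suc m) = begin
    suc m * suc m                                ≡⟨ solve 1 (λ m → (con 1 :+ m) :* (con 1 :+ m) := con 1 :+ (m :+ m :+ m :* m)) refl m ⟩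
    suc (m + m + m * m)                          ≡⟨ cong (λ z → suc (m + m + z)) (square≡triangle m) ⟩
    suc (m + m + (triangle m + triangle m + m))  ≡⟨ cong suc (solve 2 (λ m t → m :+ m :+ (t :+ t :+ m) := m :+ t :+ (m :+ t) :+ m) refl m (triangle m)) ⟩
    suc (m + triangle m + (m + triangle m) + m)  ≡⟨ +-suc (m + triangle m + (m + triangle m)) m ⟨
    m + triangle m + (m + triangle m) + suc m    ∎

  module ExponentIdentities (n d : ℕ) where

    open AbstractITC.Rounds n d

    cliquePairs : List (ℕ × ℕ) → ℕ
    cliquePairs []            = 0
    cliquePairs ((b , a) ∷ s) = a C 2 + cliquePairs s

    vShift : ℕ → ℕ → List (ℕ × ℕ) → ℕ
    vShift A B []            = 0
    vShift A B ((b , a) ∷ s) = a * suc (A + (B + b)) + vShift (A + a) (B + b) s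

    wShift : ℕ → List (ℕ × ℕ) → ℕ
    wShift A []            = 0
    wShift A ((b , a) ∷ s) = b * A + wShift (A + a) s

    shifts+pairs : ∀ A B s → vShift A B s + wShift A s + cliquePairs s + triangle A + A * B + A
                             ≡ triangle (A + totalP s) + (A + totalP s) * (B + totalQ s) + (A + totalP s)
    shifts+pairs A B [] rewrite +-identityʳ A | +-identityʳ B = refl
    shifts+pairs A B ((b , a) ∷ s) = begin
      a * suc (A + (B + b)) + X + (b * A + Y) + (a C 2 + G) + triangle A + A * B + A
        ≡⟨ cong (λ t → a * suc (A + (B + b)) + X + (b * A + Y) + (t + G) + triangle A + A * B + A) (C2≡triangle a) ⟩
      a * suc (A + (B + b)) + X + (b * A + Y) + (triangle a + G) + triangle A + A * B + A
        ≡⟨ solve 9 (λ a A B b X Y G ta tA → a :* (con 1 :+ (A :+ (B :+ b))) :+ X :+ (b :* A :+ Y) :+ (ta :+ G) :+ tA :+ A :* B :+ A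
                      := X :+ Y :+ G :+ (tA :+ A :* a :+ ta) :+ (A :+ a) :* (B :+ b) :+ (A :+ a))
             refl a A B b X Y G (triangle a) (triangle A) ⟩
      X + Y + G + (triangle A + A * a + triangle a) + (A + a) * (B + b) + (A + a)
        ≡⟨ cong (λ t → X + Y + G + t + (A + a) * (B + b) + (A + a)) (triangle-+ A a) ⟨
      X + Y + G + triangle (A + a) + (A + a) * (B + b) + (A + a)
        ≡⟨ shifts+pairs (A + a) (B + b) s ⟩
      triangle (A + a + totalP s) + (A + a + totalP s) * (B + b + totalQ s) + (A + a + totalP s)
        ≡⟨ cong₂ (λ p r → triangle p + p * r + p) (+-assoc A a (totalP s)) (+-assoc B b (totalQ s)) ⟩
      triangle (A + (a + totalP s)) + (A + (a + totalP s)) * (B + (b + totalQ s)) + (A + (a + totalP s)) ∎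
      where
      X = vShift (A + a) (B + b) s
      Y = wShift (A + a) s
      G = cliquePairs s

    private
      *-∸-+ : ∀ a {T m} → (1 ≤ a → T ≤ m) → a * (m ∸ T) + a * T ≡ a * m
      *-∸-+ zero    _   = refl
      *-∸-+ (suc a) {T} {m} T≤m = trans (sym (*-distribˡ-+ (suc a) (m ∸ T) T)) (cong (suc a *_) (m∸n+n≡m (T≤m (s≤s z≤n))))

    floorSum-vThresholds : ∀ A B s → A + totalP s ≡ n → B + totalQ s ≡ d →
      floorSum (vThresholds A B s) + vShift A B s ≡ totalP s * (n + d)
    floorSum-vThresholds A B []            _    _    = refl
    floorSum-vThresholds A B ((b , a) ∷ s) A+P≡n B+Q≡d = begin
      a * θ + F + (a * T + X)     ≡⟨ solve 4 (λ p E q X → p :+ E :+ (q :+ X) := (p :+ q) :+ (E :+ X)) refl (a * θ) F (a * T) X ⟩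
      (a * θ + a * T) + (F + X)   ≡⟨ cong₂ _+_ (*-∸-+ a T≤n+d)
                                           (floorSum-vThresholds (A + a) (B + b) s (trans (+-assoc A a _) A+P≡n) (trans (+-assoc B b _) B+Q≡d)) ⟩
      a * (n + d) + totalP s * (n + d) ≡⟨ *-distribʳ-+ (n + d) a (totalP s) ⟨
      (a + totalP s) * (n + d)    ∎
      where
      T = suc (A + (B + b))
      θ = (n + d) ∸ T
      F = floorSum (vThresholds (A + a) (B + b) s)
      X = vShift (A + a) (B + b) s
      T≤n+d : 1 ≤ a → T ≤ n + d
      T≤n+d 1≤a = +-mono-≤ {suc A} (≤-trans (≤-trans (≤-reflexive (+-comm 1 A)) (+-monoʳ-≤ A 1≤a)) A+a≤n) B+b≤d
        where
        A+a≤n = ≤-trans (m≤m+n (A + a) (totalP s)) (≤-reflexive (trans (+-assoc A a _) A+P≡n))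
        B+b≤d = ≤-trans (m≤m+n (B + b) (totalQ s)) (≤-reflexive (trans (+-assoc B b _) B+Q≡d))

    floorSum-wThresholds : ∀ A B s → A + totalP s ≡ n → floorSum (wThresholds A B s) + wShift A s ≡ totalQ s * n
    floorSum-wThresholds A B []            _    = refl
    floorSum-wThresholds A B ((b , a) ∷ s) A+P≡n = begin
      b * (n ∸ A) + F + (b * A + Y)     ≡⟨ solve 4 (λ p E q Y → p :+ E :+ (q :+ Y) := (p :+ q) :+ (E :+ Y)) refl (b * (n ∸ A)) F (b * A) Y ⟩
      (b * (n ∸ A) + b * A) + (F + Y)   ≡⟨ cong₂ _+_ (*-∸-+ b (λ _ → ≤-trans (m≤m+n A (a + totalP s)) (≤-reflexive A+P≡n)))
                                                 (floorSum-wThresholds (A + a) (B + b) s (trans (+-assoc A a _) A+P≡n)) ⟩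
      b * n + totalQ s * n              ≡⟨ *-distribʳ-+ n b (totalQ s) ⟨
      (b + totalQ s) * n                ∎
      where
      F = floorSum (wThresholds (A + a) (B + b) s)
      Y = wShift (A + a) s

    levelOffset : ℕ
    levelOffset = ((n + d) C 2) ∸ (d C 2)

    levelOffset≡ : levelOffset ≡ triangle n + n * d
    levelOffset≡ = begin
      ((n + d) C 2) ∸ (d C 2)                    ≡⟨ cong₂ _∸_ (trans (C2≡triangle (n + d)) (triangle-+ n d)) (C2≡triangle d) ⟩
      (triangle n + n * d + triangle d) ∸ triangle d ≡⟨ m+n∸n≡m (triangle n + n * d) (triangle d) ⟩
      triangle n + n * d                         ∎

    floorSums≡ : ∀ s → totalP s ≡ n → totalQ s ≡ d →
      floorSum (vThresholds 0 0 s) + floorSum (wThresholds 0 0 s) ≡ levelOffset + cliquePairs s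
    floorSums≡ s P≡n Q≡d = +-cancelʳ-≡ Z _ _ (begin
      EV + EW + Z                                      ≡⟨ cong (EV + EW +_) shifts≡Z ⟨
      EV + EW + (vShift 0 0 s + wShift 0 s + cliquePairs s)
        ≡⟨ solve 5 (λ a b x y g → a :+ b :+ (x :+ y :+ g) := (a :+ x) :+ (b :+ y) :+ g) refl EV EW (vShift 0 0 s) (wShift 0 s) (cliquePairs s) ⟩
      (EV + vShift 0 0 s) + (EW + wShift 0 s) + cliquePairs s
        ≡⟨ cong₂ (λ p r → p + r + cliquePairs s) (floorSum-vThresholds 0 0 s P≡n Q≡d) (floorSum-wThresholds 0 0 s P≡n) ⟩
      totalP s * (n + d) + totalQ s * n + cliquePairs s ≡⟨ cong₂ (λ p r → p * (n + d) + r * n + cliquePairs s) P≡n Q≡d ⟩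
      n * (n + d) + d * n + cliquePairs s
        ≡⟨ cong (_+ cliquePairs s) (trans (solve 2 (λ n d → n :* (n :+ d) :+ d :* n := n :* n :+ con 2 :* (n :* d)) refl n d)
                                          (cong (_+ 2 * (n * d)) (square≡triangle n))) ⟩
      triangle n + triangle n + n + 2 * (n * d) + cliquePairs s
        ≡⟨ solve 4 (λ t m nd g → t :+ t :+ m :+ con 2 :* nd :+ g := t :+ nd :+ g :+ (t :+ nd :+ m)) refl (triangle n) n (n * d) (cliquePairs s) ⟩
      triangle n + n * d + cliquePairs s + Z           ≡⟨ cong (λ k → k + cliquePairs s + Z) levelOffset≡ ⟨
      levelOffset + cliquePairs s + Z                  ∎)
      where
      Z = triangle n + n * d + n
      EV = floorSum (vThresholds 0 0 s)
      EW = floorSum (wThresholds 0 0 s)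
      shifts≡Z : vShift 0 0 s + wShift 0 s + cliquePairs s ≡ Z
      shifts≡Z = begin
        vShift 0 0 s + wShift 0 s + cliquePairs s               ≡⟨ solve 1 (λ k → k := k :+ con 0 :+ con 0 :+ con 0) refl _ ⟩
        vShift 0 0 s + wShift 0 s + cliquePairs s + 0 + 0 + 0   ≡⟨ shifts+pairs 0 0 s ⟩
        triangle (totalP s) + totalP s * totalQ s + totalP s    ≡⟨ cong₂ (λ p r → triangle p + p * r + p) P≡n Q≡d ⟩
        Z                                                       ∎

    qmultinomProduct : ℕ → ℕ → List (ℕ × ℕ) → ℕ
    qmultinomProduct q aprev []            = 1
    qmultinomProduct q aprev ((b , a) ∷ s) = qmultinom q a b (aprev ∸ 1) * qmultinomProduct q a s

    tExponent : ℕ → List (ℕ × ℕ) → ℕ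
    tExponent i []            = 0
    tExponent i ((b , a) ∷ s) = (i ∸ 1) * (a + b) + tExponent (suc i) s

    itcTerm≡ : ∀ q t i aprev s → itcTerm q t i aprev s ≡ q ^ cliquePairs s * qmultinomProduct q aprev s * t ^ tExponent i s
    itcTerm≡ q t i aprev []            = refl
    itcTerm≡ q t i aprev ((b , a) ∷ s) = begin
      q ^ (a C 2) * M * t ^ ((i ∸ 1) * (a + b)) * itcTerm q t (suc i) a s
        ≡⟨ cong (q ^ (a C 2) * M * t ^ ((i ∸ 1) * (a + b)) *_) (itcTerm≡ q t (suc i) a s) ⟩
      q ^ (a C 2) * M * t ^ ((i ∸ 1) * (a + b)) * (q ^ cliquePairs s * qmultinomProduct q a s * t ^ tExponent (suc i) s)
        ≡⟨ solve 6 (λ x m y g r z → x :* m :* y :* (g :* r :* z) := x :* g :* (m :* r) :* (y :* z))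
             refl (q ^ (a C 2)) M (t ^ ((i ∸ 1) * (a + b))) (q ^ cliquePairs s) (qmultinomProduct q a s) (t ^ tExponent (suc i) s) ⟩
      q ^ (a C 2) * q ^ cliquePairs s * (M * qmultinomProduct q a s) * (t ^ ((i ∸ 1) * (a + b)) * t ^ tExponent (suc i) s)
        ≡⟨ cong₂ (λ u v → u * (M * qmultinomProduct q a s) * v) (^-distribˡ-+-* q (a C 2) (cliquePairs s))
                                                                (^-distribˡ-+-* t ((i ∸ 1) * (a + b)) (tExponent (suc i) s)) ⟨
      q ^ (a C 2 + cliquePairs s) * (M * qmultinomProduct q a s) * t ^ ((i ∸ 1) * (a + b) + tExponent (suc i) s) ∎
      where
      M = qmultinom q a b (aprev ∸ 1)

    wsum≡ : ∀ i s → wsum (suc i) s ≡ tExponent (suc i) s + (totalP s + totalQ s)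
    wsum≡ i []            = refl
    wsum≡ i ((b , a) ∷ s) = begin
      suc i * (b + a) + wsum (suc (suc i)) s                               ≡⟨ cong (suc i * (b + a) +_) (wsum≡ (suc i) s) ⟩
      suc i * (b + a) + (tExponent (suc (suc i)) s + (totalP s + totalQ s))
        ≡⟨ solve 6 (λ i b a T x y → (con 1 :+ i) :* (b :+ a) :+ (T :+ (x :+ y)) := i :* (a :+ b) :+ T :+ (a :+ x :+ (b :+ y)))
             refl i b a (tExponent (suc (suc i)) s) (totalP s) (totalQ s) ⟩
      i * (a + b) + tExponent (suc (suc i)) s + (a + totalP s + (b + totalQ s)) ∎

    ThresholdsBelow-vThresholds : ∀ A B s {hi} → (n + d) ∸ suc (A + B) ≤ hi → ThresholdsBelow hi (vThresholds A B s)
    ThresholdsBelow-vThresholds A B []            _  = tt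
    ThresholdsBelow-vThresholds A B ((b , a) ∷ s) le =
      ≤-trans (∸-monoʳ-≤ (n + d) (s≤s (+-monoʳ-≤ A (m≤m+n B b)))) le ,
      ThresholdsBelow-vThresholds (A + a) (B + b) s (∸-monoʳ-≤ (n + d) (s≤s (+-monoˡ-≤ (B + b) (m≤m+n A a))))

    ThresholdsBelow-wThresholds : ∀ A B s {hi} → n ∸ A ≤ hi → ThresholdsBelow hi (wThresholds A B s)
    ThresholdsBelow-wThresholds A B []            _  = tt
    ThresholdsBelow-wThresholds A B ((b , a) ∷ s) le = le , ThresholdsBelow-wThresholds (A + a) (B + b) s (∸-monoʳ-≤ n (m≤m+n A a))

    VBound : ℕ → ℕ → ℕ → ℕ → List (ℕ × ℕ) → Set
    VBound hi A B aprev []            = ⊤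
    VBound hi A B aprev ((b , a) ∷ s) = 1 ≤ a → hi ≡ ((n + d) ∸ suc (A + (B + b))) + (b + aprev)

    WBound : ℕ → ℕ → ℕ → List (ℕ × ℕ) → Set
    WBound hi A aprev []      = ⊤
    WBound hi A aprev (_ ∷ s) = hi ≡ (n ∸ A) + aprev

    private
      blockGF : ∀ q a lo M → ∑ (decreasingVecs a lo (lo + suc M)) (λ u → q ^ (sum u ∸ a * lo)) ≡ qbinom q (a + M) a
      blockGF q a lo M = trans (∑-decreasingVecs q a lo M) (sym (qbinom-sym q a M))

      ∸-+-shift : ∀ m T k → T + k ≤ m → (m ∸ (T + k)) + k ≡ m ∸ T
      ∸-+-shift m T k T+k≤m =
        trans (cong (_+ k) (sym (∸-+-assoc m T k))) (m∸n+n≡m (m+n≤o⇒m≤o∸n k (≤-trans (≤-reflexive (+-comm k T)) T+k≤m)))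

    vBlockGF : ∀ q a {b c θ hi} → (1 ≤ a → hi ≡ θ + (b + suc c)) →
      ∑ (decreasingVecs a θ hi) (λ u → q ^ (sum u ∸ a * θ)) ≡ qbinom q (a + (b + c)) a
    vBlockGF q zero    _    = refl
    vBlockGF q (suc a) {b} {c} {θ} hi≡ =
      trans (cong (λ hi → ∑ (decreasingVecs (suc a) θ hi) (λ u → q ^ (sum u ∸ suc a * θ))) (trans (hi≡ (s≤s z≤n)) (cong (θ +_) (+-suc b c))))
            (blockGF q (suc a) θ (b + c))

    VBound-next : ∀ A B a b b′ a′ s → A + (a + totalP ((b′ , a′) ∷ s)) ≡ n → B + (b + totalQ ((b′ , a′) ∷ s)) ≡ d →
      VBound ((n + d) ∸ suc (A + (B + b))) (A + a) (B + b) a ((b′ , a′) ∷ s)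
    VBound-next A B a b b′ a′ s A+P≡n B+Q≡d a′>0 =
      sym (trans (cong (λ z → ((n + d) ∸ z) + (b′ + a)) T≡) (∸-+-shift (n + d) T (b′ + a) (≤-trans (≤-reflexive (sym T≡)) fits)))
      where
      T = suc (A + (B + b))
      T≡ : suc ((A + a) + ((B + b) + b′)) ≡ T + (b′ + a)
      T≡ = cong suc (solve 5 (λ A a B b b′ → (A :+ a) :+ ((B :+ b) :+ b′) := A :+ (B :+ b) :+ (b′ :+ a)) refl A a B b b′)
      A+a<n : suc (A + a) ≤ n
      A+a<n = ≤-trans (≤-trans (≤-reflexive (+-comm 1 (A + a))) (+-monoʳ-≤ (A + a) (≤-trans a′>0 (m≤m+n a′ (totalP s)))))
                      (≤-reflexive (trans (+-assoc A a _) A+P≡n))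
      B+b+b′≤d : B + b + b′ ≤ d
      B+b+b′≤d = ≤-trans (m≤m+n (B + b + b′) (totalQ s))
                         (≤-reflexive (trans (+-assoc (B + b) b′ (totalQ s)) (trans (+-assoc B b _) B+Q≡d)))
      fits : suc ((A + a) + ((B + b) + b′)) ≤ n + d
      fits = +-mono-≤ A+a<n B+b+b′≤d

    WBound-next : ∀ A a s → A + (a + totalP s) ≡ n → WBound (n ∸ A) (A + a) a s
    WBound-next A a []      _     = tt
    WBound-next A a (_ ∷ s) A+P≡n = sym (∸-+-shift n A a (≤-trans (m≤m+n (A + a) _) (≤-reflexive (trans (+-assoc A a _) A+P≡n))))

    groupsGF-product : ∀ q s A B aprev hiV hiW → 1 ≤ aprev → A + totalP s ≡ n → B + totalQ s ≡ d → PositiveBeforeLast s →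
      VBound hiV A B aprev s → WBound hiW A aprev s →
      groupsGF q hiV (vThresholds A B s) * groupsGF q hiW (wThresholds A B s) ≡ qmultinomProduct q aprev s
    groupsGF-product q []            A B aprev hiV hiW _ _ _ _ _ _ = refl
    groupsGF-product q ((b , a) ∷ s) A B (suc c) hiV hiW _ A+P≡n B+Q≡d (a>0∨last , positive) boundV boundW = begin
      GV * GV′ * (GW * GW′)  ≡⟨ solve 4 (λ p r u z → p :* r :* (u :* z) := p :* u :* (r :* z)) refl GV GV′ GW GW′ ⟩
      GV * GW * (GV′ * GW′)  ≡⟨ cong₂ _*_ (trans (cong₂ _*_ (vBlockGF q a boundV) wBlock) (sym (qmultinom-qbinom q a b c)))
                                          (later s a>0∨last positive A+P≡n B+Q≡d) ⟩
      qmultinom q a b c * qmultinomProduct q a s ∎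
      where
      θ = (n + d) ∸ suc (A + (B + b))
      η = n ∸ A
      GV = ∑ (decreasingVecs a θ hiV) (λ u → q ^ (sum u ∸ a * θ))
      GW = ∑ (decreasingVecs b η hiW) (λ u → q ^ (sum u ∸ b * η))
      GV′ = groupsGF q θ (vThresholds (A + a) (B + b) s)
      GW′ = groupsGF q η (wThresholds (A + a) (B + b) s)
      wBlock : GW ≡ qbinom q (b + c) b
      wBlock = trans (cong (λ hi → ∑ (decreasingVecs b η hi) (λ u → q ^ (sum u ∸ b * η))) boundW) (blockGF q b η c)
      later : ∀ s′ → (s′ ≡ [] ⊎ 1 ≤ a) → PositiveBeforeLast s′ → A + (a + totalP s′) ≡ n → B + (b + totalQ s′) ≡ d →
        groupsGF q θ (vThresholds (A + a) (B + b) s′) * groupsGF q η (wThresholds (A + a) (B + b) s′) ≡ qmultinomProduct q a s′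
      later []               _          _         _      _      = refl
      later ((b′ , a′) ∷ s″) (inj₁ ())  _         _      _
      later ((b′ , a′) ∷ s″) (inj₂ a>0) positive′ A+P≡n′ B+Q≡d′ =
        groupsGF-product q ((b′ , a′) ∷ s″) (A + a) (B + b) a θ η a>0 (trans (+-assoc A a _) A+P≡n′) (trans (+-assoc B b _) B+Q≡d′)
                         positive′ (VBound-next A B a b b′ a′ s″ A+P≡n′ B+Q≡d′) (WBound-next A a ((b′ , a′) ∷ s″) A+P≡n′)

module FibreDecomposition where

  open import Defs
  open Sums
  open DecreasingVectors
  open Thresholds
  open Exponents
  open import Data.Nat as ℕ using (ℕ; suc; _≤_; _<_; z≤n; s≤s; _+_; _*_; _∸_; _^_)
  import Data.Nat.Properties as ℕ
  open import Data.Nat.Solver using (module +-*-Solver)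
  open import Data.Integer using (+<+)
  open import Data.Bool using (Bool; true; false; _∧_; if_then_else_; T; T?)
  open import Data.List using (List; []; _∷_; map; upTo; length; filter; deduplicate; cartesianProduct)
  import Data.List.Properties as List
  import Data.Product.Properties as Product
  open import Data.List.Membership.Propositional using (_∈_)
  open import Data.List.Membership.Propositional.Properties
    using ( ∈-map⁺; ∈-map⁻; ∈-deduplicate⁺; ∈-deduplicate⁻; ∈-filter⁺; ∈-filter⁻; ∈-upTo⁺
          ; ∈-cartesianProduct⁺; ∈-cartesianProduct⁻)
  open import Data.List.Relation.Unary.Unique.Propositional using (Unique)
  import Data.List.Relation.Unary.Unique.Propositional.Properties as Unique
  import Data.List.Relation.Unary.Unique.DecPropositional.Properties as DecUnique
  open import Data.Product using (_×_; _,_; proj₁; proj₂)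
  open import Data.Unit using (tt)
  open import Data.Product.Properties using (,-injectiveˡ; ,-injectiveʳ)
  open import Data.Vec using (Vec; sum; lookup)
  open import Function.Bundles using (_⇔_; Equivalence)
  open import Relation.Binary.Definitions using (DecidableEquality)
  open import Relation.Binary.PropositionalEquality
  open import Relation.Nullary using (does; Dec)
  open ≡-Reasoning

  _≟ₛ_ : DecidableEquality (List (ℕ × ℕ))
  _≟ₛ_ = List.≡-dec (Product.≡-dec ℕ._≟_ ℕ._≟_)

  SortedRec⇒DecreasingIn : ∀ {n d} (c : SConf n d) → SortedRec c → DecreasingIn (proj₁ c) 0 (n + d) × DecreasingIn (proj₂ c) 0 (suc n)
  SortedRec⇒DecreasingIn {n} {d} c (x↓ , y↓ , stable , _) =
    WeaklyDecreasing⇒DecreasingIn (proj₁ c) x↓ x-bound , WeaklyDecreasing⇒DecreasingIn (proj₂ c) y↓ y-bound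
    where
    x-bound : ∀ i → lookup (proj₁ c) i < n + d
    x-bound i with stable (v i) refl
    ... | +<+ x<deg = x<deg
    y-bound : ∀ j → lookup (proj₂ c) j < suc n
    y-bound j with stable (w j) refl
    ... | +<+ y<deg = ℕ.≤-trans y<deg (ℕ.≤-reflexive (ℕ.+-comm n 1))

  module Proof (n d : ℕ) (L : List (SConf n d)) (!L : Unique L) (L⇔ : (c : SConf n d) → (c ∈ L) ⇔ SortedRec c) (q t : ℕ) where

    open AbstractITC.Rounds n d
    open ExponentIdentities n d

    ∈L⇒SortedRec : ∀ {c} → c ∈ L → SortedRec c
    ∈L⇒SortedRec {c} = Equivalence.to (L⇔ c)

    SortedRec⇒∈L : ∀ {c} → SortedRec c → c ∈ L
    SortedRec⇒∈L {c} = Equivalence.from (L⇔ c)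

    weight : SConf n d → ℕ
    weight c = q ^ level c * t ^ (wtopple c ∸ (n + d))

    candidates : List (SConf n d)
    candidates = cartesianProduct (decreasingVecs n 0 (n + d)) (decreasingVecs d 0 (suc n))

    candidates-unique : Unique candidates
    candidates-unique = Unique.cartesianProduct⁺ (decreasingVecs-unique n 0 (n + d)) (decreasingVecs-unique d 0 (suc n))

    ∈-candidates⁺ : ∀ {x : Vec ℕ n} {y : Vec ℕ d} → DecreasingIn x 0 (n + d) → DecreasingIn y 0 (suc n) → (x , y) ∈ candidates
    ∈-candidates⁺ x↓ y↓ = ∈-cartesianProduct⁺ (∈-decreasingVecs⁺ n 0 (n + d) _ x↓) (∈-decreasingVecs⁺ d 0 (suc n) _ y↓)

    ∈-candidates⁻ : ∀ {x : Vec ℕ n} {y : Vec ℕ d} → (x , y) ∈ candidates → DecreasingIn x 0 (n + d) × DecreasingIn y 0 (suc n)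
    ∈-candidates⁻ xy∈ with ∈-cartesianProduct⁻ (decreasingVecs n 0 (n + d)) (decreasingVecs d 0 (suc n)) xy∈
    ... | x∈ , y∈ = ∈-decreasingVecs⁻ n 0 (n + d) x∈ , ∈-decreasingVecs⁻ d 0 (suc n) y∈

    module Fibre (s : List (ℕ × ℕ)) (c* : SConf n d) (c*∈L : c* ∈ L) (c*↦s : itcSeq c* ≡ s) where

      private
        x*↓ = proj₁ (SortedRec⇒DecreasingIn c* (∈L⇒SortedRec c*∈L))
        y*↓ = proj₂ (SortedRec⇒DecreasingIn c* (∈L⇒SortedRec c*∈L))

      module D* = Toppling.Dynamics n d (proj₁ c*) (proj₂ c*) x*↓ y*↓
      module R* = AbstractITC.Run n d (proj₁ c*) (proj₂ c*)

      s≡run* : s ≡ R*.run (suc (n + d)) 0 0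
      s≡run* = trans (sym c*↦s) D*.itcSeq≡run

      complete* : R*.runEnd (suc (n + d)) 0 0 ≡ (n , d)
      complete* = D*.recurrent⇒runEnd≡ (proj₂ (proj₂ (∈L⇒SortedRec c*∈L)))

      Conditions : SConf n d → Bool
      Conditions c = countsMatch 0 (vThresholds 0 0 s) (proj₁ c) ∧ countsMatch 0 (wThresholds 0 0 s) (proj₂ c)

      conditions⇒fibre : ∀ {x : Vec ℕ n} {y : Vec ℕ d} → DecreasingIn x 0 (n + d) → DecreasingIn y 0 (suc n) →
        countsMatch 0 (vThresholds 0 0 s) x ≡ true → countsMatch 0 (wThresholds 0 0 s) y ≡ true → itcSeq (x , y) ≡ s × SortedRec (x , y)
      conditions⇒fibre {x} {y} x↓ y↓ match-x match-y =
        trans Dx.itcSeq≡run (trans (proj₁ agree) (sym s≡run*)) ,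
        DecreasingIn⇒WeaklyDecreasing x x↓ , DecreasingIn⇒WeaklyDecreasing y y↓ , Dx.runEnd≡⇒recurrent (proj₂ agree)
        where
        module Dx = Toppling.Dynamics n d x y x↓ y↓
        agree = AbstractITC.RunAgreement.runs-agree n d x y (proj₁ c*) (proj₂ c*) (suc (n + d)) 0 0 R*.BelowReach-0 complete*
                  (subst (λ s → countsMatch 0 (vThresholds 0 0 s) x ≡ true) s≡run* match-x)
                  (subst (λ s → countsMatch 0 (wThresholds 0 0 s) y ≡ true) s≡run* match-y)

      fibre⇒conditions : ∀ {x : Vec ℕ n} {y : Vec ℕ d} → SortedRec (x , y) → itcSeq (x , y) ≡ s → Conditions (x , y) ≡ true
      fibre⇒conditions {x} {y} sorted x,y↦s =
        ∧-intro (subst (λ s → countsMatch 0 (vThresholds 0 0 s) x ≡ true) run≡s (proj₁ match))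
                (subst (λ s → countsMatch 0 (wThresholds 0 0 s) y ≡ true) run≡s (proj₂ match))
        where
        module Dx = Toppling.Dynamics n d x y (proj₁ (SortedRec⇒DecreasingIn (x , y) sorted)) (proj₂ (SortedRec⇒DecreasingIn (x , y) sorted))
        module Rx = AbstractITC.Run n d x y
        match = Rx.run-countsMatch (suc (n + d)) 0 0 Rx.BelowReach-0
        run≡s = trans (sym Dx.itcSeq≡run) x,y↦s
        ∧-intro : ∀ {a b} → a ≡ true → b ≡ true → (a ∧ b) ≡ true
        ∧-intro refl refl = refl

      private
        ∧-elim : ∀ {a b} → (a ∧ b) ≡ true → a ≡ true × b ≡ true
        ∧-elim {true} {true} _ = refl , refl

      fibre-sum≡conditions-sum :
        ∑ L (λ c → if does (itcSeq c ≟ₛ s) then weight c else 0) ≡ ∑ candidates (λ c → if Conditions c then weight c else 0)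
      fibre-sum≡conditions-sum = ∑-filter-unique (λ c → itcSeq c ≟ₛ s) (λ c → T? (Conditions c)) L candidates !L candidates-unique
        in-fibre⇒conditions conditions⇒in-fibre weight
        where
        in-fibre⇒conditions : ∀ {c} → c ∈ L → itcSeq c ≡ s → c ∈ candidates × T (Conditions c)
        in-fibre⇒conditions {x , y} c∈L c↦s with SortedRec⇒DecreasingIn (x , y) (∈L⇒SortedRec c∈L)
        ... | x↓ , y↓ = ∈-candidates⁺ x↓ y↓ , ≡true⇒T (fibre⇒conditions (∈L⇒SortedRec c∈L) c↦s)
        conditions⇒in-fibre : ∀ {c} → c ∈ candidates → T (Conditions c) → c ∈ L × itcSeq c ≡ s
        conditions⇒in-fibre {x , y} c∈ conditions = SortedRec⇒∈L (proj₂ in-fibre) , proj₁ in-fibre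
          where
          match = ∧-elim (T⇒≡true conditions)
          in-fibre = conditions⇒fibre (proj₁ (∈-candidates⁻ c∈)) (proj₂ (∈-candidates⁻ c∈)) (proj₁ match) (proj₂ match)

      totals : (totalP s , totalQ s) ≡ (n , d)
      totals = subst (λ s → (totalP s , totalQ s) ≡ (n , d)) (sym s≡run*) (trans (R*.run-totals (suc (n + d)) 0 0 R*.BelowReach-0) complete*)

      totalP≡n : totalP s ≡ n
      totalP≡n = ,-injectiveˡ totals

      totalQ≡d : totalQ s ≡ d
      totalQ≡d = ,-injectiveʳ totals

      positive : PositiveBeforeLast s
      positive = subst PositiveBeforeLast (sym s≡run*) (R*.run-positive (suc (n + d)) 0 0 R*.BelowReach-0)

      wtopple-offset : ∀ (c : SConf n d) → itcSeq c ≡ s → wtopple c ∸ (n + d) ≡ tExponent 1 s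
      wtopple-offset c c↦s = begin
        wsum 1 (itcSeq c) ∸ (n + d)                ≡⟨ cong (λ s → wsum 1 s ∸ (n + d)) c↦s ⟩
        wsum 1 s ∸ (n + d)                         ≡⟨ cong (_∸ (n + d)) (wsum≡ 0 s) ⟩
        (tExponent 1 s + (totalP s + totalQ s)) ∸ (n + d) ≡⟨ cong (λ k → (tExponent 1 s + k) ∸ (n + d)) (cong₂ _+_ totalP≡n totalQ≡d) ⟩
        (tExponent 1 s + (n + d)) ∸ (n + d)        ≡⟨ ℕ.m+n∸n≡m (tExponent 1 s) (n + d) ⟩
        tExponent 1 s                              ∎

      Vs = vThresholds 0 0 s
      Ws = wThresholds 0 0 s

      Vs-below : ThresholdsBelow (n + d) Vs
      Vs-below = ThresholdsBelow-vThresholds 0 0 s (ℕ.m∸n≤m (n + d) 1)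

      Ws-below : ThresholdsBelow (suc n) Ws
      Ws-below = ThresholdsBelow-wThresholds 0 0 s (ℕ.n≤1+n n)

      groupTotal-Vs : groupTotal Vs ≡ n
      groupTotal-Vs = trans (groupTotal-vThresholds 0 0 s) totalP≡n

      groupTotal-Ws : groupTotal Ws ≡ d
      groupTotal-Ws = trans (groupTotal-wThresholds 0 0 s) totalQ≡d

      level≡ : ∀ (x : Vec ℕ n) (y : Vec ℕ d) → floorSum Vs ≤ sum x → floorSum Ws ≤ sum y →
        level (x , y) ≡ (sum x ∸ floorSum Vs) + (sum y ∸ floorSum Ws) + cliquePairs s
      level≡ x y Vs≤x Ws≤y = begin
        (sum x + sum y) ∸ levelOffset
          ≡⟨ cong₂ (λ a b → (a + b) ∸ levelOffset) (sym (ℕ.m∸n+n≡m Vs≤x)) (sym (ℕ.m∸n+n≡m Ws≤y)) ⟩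
        (X + floorSum Vs + (Y + floorSum Ws)) ∸ levelOffset
          ≡⟨ cong (_∸ levelOffset) (solve 4 (λ a e b f → a :+ e :+ (b :+ f) := a :+ b :+ (e :+ f)) refl X (floorSum Vs) Y (floorSum Ws)) ⟩
        (X + Y + (floorSum Vs + floorSum Ws)) ∸ levelOffset
          ≡⟨ cong (λ k → (X + Y + k) ∸ levelOffset) (floorSums≡ s totalP≡n totalQ≡d) ⟩
        (X + Y + (levelOffset + cliquePairs s)) ∸ levelOffset
          ≡⟨ cong (_∸ levelOffset) (solve 4 (λ a b k g → a :+ b :+ (k :+ g) := a :+ b :+ g :+ k) refl X Y levelOffset (cliquePairs s)) ⟩
        (X + Y + cliquePairs s + levelOffset) ∸ levelOffset                  ≡⟨ ℕ.m+n∸n≡m _ levelOffset ⟩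
        X + Y + cliquePairs s                                                ∎
        where
        open +-*-Solver
        X = sum x ∸ floorSum Vs
        Y = sum y ∸ floorSum Ws

      vWeight : Vec ℕ n → ℕ
      vWeight x = if countsMatch 0 Vs x then q ^ (sum x ∸ floorSum Vs) else 0

      wWeight : Vec ℕ d → ℕ
      wWeight y = if countsMatch 0 Ws y then q ^ (sum y ∸ floorSum Ws) else 0

      qtFactor : ℕ
      qtFactor = q ^ cliquePairs s * t ^ tExponent 1 s

      weight-on-fibre : ∀ (c : SConf n d) → c ∈ candidates →
        (if Conditions c then weight c else 0) ≡ (if Conditions c then q ^ level c * t ^ tExponent 1 s else 0)
      weight-on-fibre c c∈ with Conditions c in conditions
      ... | false = refl
      ... | true  = cong (λ e → q ^ level c * t ^ e) (wtopple-offset c (proj₁ (conditions⇒fibre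
                      (proj₁ (∈-candidates⁻ c∈)) (proj₂ (∈-candidates⁻ c∈)) (proj₁ match) (proj₂ match))))
        where
        match = ∧-elim {countsMatch 0 Vs (proj₁ c)} {countsMatch 0 Ws (proj₂ c)} conditions

      weight-factorises : ∀ (x : Vec ℕ n) (y : Vec ℕ d) → DecreasingIn x 0 (n + d) → DecreasingIn y 0 (suc n) →
        (if Conditions (x , y) then q ^ level (x , y) * t ^ tExponent 1 s else 0) ≡ vWeight x * wWeight y * qtFactor
      weight-factorises x y x↓ y↓ with countsMatch 0 Vs x in match-x | countsMatch 0 Ws y in match-y
      ... | false | _     = refl
      ... | true  | false = cong (_* qtFactor) (sym (ℕ.*-zeroʳ (q ^ (sum x ∸ floorSum Vs))))
      ... | true  | true  = begin
        q ^ level (x , y) * t ^ tExponent 1 s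
          ≡⟨ cong (λ e → q ^ e * t ^ tExponent 1 s) (level≡ x y (countsMatch⇒floorSum≤sum Vs (sym groupTotal-Vs) x Vs-below x↓ match-x)
                                                             (countsMatch⇒floorSum≤sum Ws (sym groupTotal-Ws) y Ws-below y↓ match-y)) ⟩
        q ^ (X + Y + cliquePairs s) * t ^ tExponent 1 s
          ≡⟨ cong (_* t ^ tExponent 1 s) (trans (ℕ.^-distribˡ-+-* q (X + Y) (cliquePairs s)) (cong (_* q ^ cliquePairs s) (ℕ.^-distribˡ-+-* q X Y))) ⟩
        q ^ X * q ^ Y * q ^ cliquePairs s * t ^ tExponent 1 s ≡⟨ ℕ.*-assoc (q ^ X * q ^ Y) (q ^ cliquePairs s) (t ^ tExponent 1 s) ⟩
        q ^ X * q ^ Y * qtFactor ∎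
        where
        X = sum x ∸ floorSum Vs
        Y = sum y ∸ floorSum Ws

      conditions-sum≡ : ∑ candidates (λ c → if Conditions c then weight c else 0) ≡ itcTerm q t 1 1 s
      conditions-sum≡ = begin
        ∑ candidates (λ c → if Conditions c then weight c else 0)
          ≡⟨ ∑-cong candidates weight-on-fibre ⟩
        ∑ candidates (λ c → if Conditions c then q ^ level c * t ^ tExponent 1 s else 0)
          ≡⟨ ∑-cartesianProduct Xs Ys (λ c → if Conditions c then q ^ level c * t ^ tExponent 1 s else 0) ⟩
        ∑ Xs (λ x → ∑ Ys (λ y → if Conditions (x , y) then q ^ level (x , y) * t ^ tExponent 1 s else 0))
          ≡⟨ ∑-cong Xs (λ x x∈ → ∑-cong Ys (λ y y∈ →
               weight-factorises x y (∈-decreasingVecs⁻ n 0 (n + d) x∈) (∈-decreasingVecs⁻ d 0 (suc n) y∈))) ⟩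
        ∑ Xs (λ x → ∑ Ys (λ y → vWeight x * wWeight y * qtFactor))
          ≡⟨ ∑-cong Xs (λ x _ → trans (∑-*ʳ Ys qtFactor (λ y → vWeight x * wWeight y)) (cong (_* qtFactor) (∑-*ˡ Ys (vWeight x) wWeight))) ⟩
        ∑ Xs (λ x → vWeight x * ∑ Ys wWeight * qtFactor)
          ≡⟨ trans (∑-*ʳ Xs qtFactor (λ x → vWeight x * ∑ Ys wWeight)) (cong (_* qtFactor) (∑-*ʳ Xs (∑ Ys wWeight) vWeight)) ⟩
        ∑ Xs vWeight * ∑ Ys wWeight * qtFactor
          ≡⟨ cong₂ (λ a b → a * b * qtFactor) (∑-countsMatch q Vs (sym groupTotal-Vs) Vs-below) (∑-countsMatch q Ws (sym groupTotal-Ws) Ws-below) ⟩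
        groupsGF q (n + d) Vs * groupsGF q (suc n) Ws * qtFactor
          ≡⟨ cong (_* qtFactor) (groupsGF-product q s 0 0 1 (n + d) (suc n) (s≤s z≤n) totalP≡n totalQ≡d positive
                                                   (vBound s totalP≡n totalQ≡d) (wBound s)) ⟩
        qmultinomProduct q 1 s * qtFactor
          ≡⟨ solve 3 (λ m g u → m :* (g :* u) := g :* m :* u) refl (qmultinomProduct q 1 s) (q ^ cliquePairs s) (t ^ tExponent 1 s) ⟩
        q ^ cliquePairs s * qmultinomProduct q 1 s * t ^ tExponent 1 s ≡⟨ itcTerm≡ q t 1 1 s ⟨
        itcTerm q t 1 1 s ∎
        where
        open +-*-Solver
        Xs = decreasingVecs n 0 (n + d)
        Ys = decreasingVecs d 0 (suc n)
        vBound : ∀ s′ → totalP s′ ≡ n → totalQ s′ ≡ d → VBound (n + d) 0 0 1 s′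
        vBound []             _    _    = tt
        vBound ((b , a) ∷ s′) P≡n Q≡d a>0 = sym (trans (cong ((n + d ∸ suc b) +_) (ℕ.+-comm b 1)) (ℕ.m∸n+n≡m 1+b≤n+d))
          where
          1+b≤n+d = ℕ.+-mono-≤ (ℕ.≤-trans a>0 (ℕ.≤-trans (ℕ.m≤m+n a (totalP s′)) (ℕ.≤-reflexive P≡n)))
                               (ℕ.≤-trans (ℕ.m≤m+n b (totalQ s′)) (ℕ.≤-reflexive Q≡d))
        wBound : ∀ s′ → WBound (suc n) 0 1 s′
        wBound []      = tt
        wBound (_ ∷ _) = ℕ.+-comm 1 n

    sequences : List (List (ℕ × ℕ))
    sequences = deduplicate _≟ₛ_ (map itcSeq L)

    sequences-unique : Unique sequences
    sequences-unique = DecUnique.deduplicate-! _≟ₛ_ (map itcSeq L)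

    itcSeq∈sequences : ∀ c → c ∈ L → itcSeq c ∈ sequences
    itcSeq∈sequences c c∈L = ∈-deduplicate⁺ _≟ₛ_ (∈-map⁺ itcSeq c∈L)

    lengths : List ℕ
    lengths = map suc (upTo (n + 1))

    lengths-unique : Unique lengths
    lengths-unique = Unique.map⁺ ℕ.suc-injective (Unique.upTo⁺ (n + 1))

    fibre-sum : ∀ s → s ∈ sequences → ∑ L (λ c → if does (itcSeq c ≟ₛ s) then weight c else 0) ≡ itcTerm q t 1 1 s
    fibre-sum s s∈ with ∈-map⁻ itcSeq (∈-deduplicate⁻ _≟ₛ_ (map itcSeq L) s∈)
    ... | c , c∈L , refl = trans (F.fibre-sum≡conditions-sum) F.conditions-sum≡
      where
      module F = Fibre (itcSeq c) c c∈L refl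

    length∈lengths : ∀ s → s ∈ sequences → length s ∈ lengths
    length∈lengths s s∈ with ∈-map⁻ itcSeq (∈-deduplicate⁻ _≟ₛ_ (map itcSeq L) s∈)
    ... | (x , y) , c∈L , refl = subst (λ s → length s ∈ lengths) (sym Dx.itcSeq≡run)
      (∈-map⁺ suc (∈-upTo⁺ (ℕ.≤-trans (Rx.run-length (suc (n + d)) 0 0 Rx.BelowReach-0) (ℕ.≤-reflexive (ℕ.+-comm 1 n)))))
      where
      x↓ = proj₁ (SortedRec⇒DecreasingIn (x , y) (∈L⇒SortedRec c∈L))
      y↓ = proj₂ (SortedRec⇒DecreasingIn (x , y) (∈L⇒SortedRec c∈L))
      module Dx = Toppling.Dynamics n d x y x↓ y↓
      module Rx = AbstractITC.Run n d x y

    ITCset-sum : ∀ k → ∑ (ITCset L k) (itcTerm q t 1 1) ≡ ∑ sequences (λ s → if does (length s ℕ.≟ k) then itcTerm q t 1 1 s else 0)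
    ITCset-sum k = trans (∑-unique (ITCset L k) (filter length≟k sequences) (DecUnique.deduplicate-! _≟ₛ_ _) (Unique.filter⁺ length≟k sequences-unique)
                                    ITCset⊆ ⊆ITCset (itcTerm q t 1 1))
                         (∑-filter length≟k sequences (itcTerm q t 1 1))
      where
      length≟k : (s : List (ℕ × ℕ)) → Dec (length s ≡ k)
      length≟k s = length s ℕ.≟ k
      ITCset⊆ : ∀ {s} → s ∈ ITCset L k → s ∈ filter length≟k sequences
      ITCset⊆ s∈ with ∈-filter⁻ length≟k {xs = map itcSeq L} (∈-deduplicate⁻ _≟ₛ_ (filter length≟k (map itcSeq L)) s∈)
      ... | s∈seqs , length≡k = ∈-filter⁺ length≟k {xs = sequences} (∈-deduplicate⁺ _≟ₛ_ {xs = map itcSeq L} s∈seqs) length≡k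
      ⊆ITCset : ∀ {s} → s ∈ filter length≟k sequences → s ∈ ITCset L k
      ⊆ITCset s∈ with ∈-filter⁻ length≟k {xs = sequences} s∈
      ... | s∈seqs , length≡k = ∈-deduplicate⁺ _≟ₛ_ {xs = filter length≟k (map itcSeq L)}
                                  (∈-filter⁺ length≟k {xs = map itcSeq L} (∈-deduplicate⁻ _≟ₛ_ (map itcSeq L) s∈seqs) length≡k)

open Sums using (∑; ∑-fibres; ∑-cong)
open FibreDecomposition using (_≟ₛ_; module Proof)
open import Defs using (SConf; SortedRec; FITC; RHS; ITCset; itcSeq; itcTerm)
open import Data.Nat using (ℕ; _≤_; _≟_)
open import Data.List using (List; length)
open import Data.Bool using (if_then_else_)
open import Relation.Nullary using (does)
open import Data.List.Relation.Unary.Unique.Propositional using (Unique)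
open import Data.List.Membership.Propositional using (_∈_)
open import Function.Bundles using (_⇔_)
open import Relation.Binary.PropositionalEquality using (_≡_; sym; module ≡-Reasoning)
open ≡-Reasoning

proposition3p9 : (n d : ℕ) → 1 ≤ n → 1 ≤ d →
    (L : List (SConf n d)) → Unique L → ((c : SConf n d) → (c ∈ L) ⇔ SortedRec c) →
    (q t : ℕ) → FITC L q t ≡ RHS L q t
-- The identity holds for all n and d.
proposition3p9 n d _ _ L !L L⇔ q t = begin
  ∑ L weight
    ≡⟨ ∑-fibres _≟ₛ_ L sequences itcSeq weight sequences-unique itcSeq∈sequences ⟩
  ∑ sequences (λ s → ∑ L (λ c → if does (itcSeq c ≟ₛ s) then weight c else 0))
    ≡⟨ ∑-cong sequences fibre-sum ⟩
  ∑ sequences (itcTerm q t 1 1)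
    ≡⟨ ∑-fibres _≟_ sequences lengths length (itcTerm q t 1 1) lengths-unique length∈lengths ⟩
  ∑ lengths (λ k → ∑ sequences (λ s → if does (length s ≟ k) then itcTerm q t 1 1 s else 0))
    ≡⟨ ∑-cong lengths (λ k _ → sym (ITCset-sum k)) ⟩
  ∑ lengths (λ k → ∑ (ITCset L k) (itcTerm q t 1 1))
    ∎
  where
  open Proof n d L !L L⇔ q t
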